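{- Let $G$ be a connected finite simple graph with vertex set $\{1,\dots,p\}$ and $q$ edges, where $q\neq 1$. Then the automorphism group of the graphicahedron $\mathcal{P}_G$ is $\Gamma(\mathcal{P}_G)= S_p\ltimes \Gamma(G)$, where $\Gamma(G)$ is the automorphism group of the graph $G$. Here $S_p$ acts on $\mathcal{P}_G$ by $(K,\alpha)\mapsto(K,\alpha\gamma)$ ($\gamma\in S_p$), a graph automorphism $\kappa$ of $G$ (viewed as a permutation of $\{1,\dots,p\}$ that also permutes edges) acts by $(K,\alpha)\mapsto(\kappa(K),\kappa\alpha\kappa^{ -1})$, and $\Gamma(G)$ normalizes $S_p$ via conjugation.
   Context: For an edge $e=\{i,j\}$ of $G$ let $\tau_e=(i\;j)\in S_p$. For $K\subseteq E(G)$ let $T_K=\langle \tau_e : e\in K\rangle\le S_p$ (trivial if $K=\emptyset$). The graphicahedron $\mathcal{P}_G$ is the poset whose elements are the pairs $(K,\alpha)$, $K\subseteq E(G)$, $\alpha\in S_p$, modulo $(K,\alpha)\sim(L,\beta)$ iff $K=L$ and $T_K\alpha=T_L\beta$, ordered by $(K,\alpha)\le(L,\beta)$ iff $K\subseteq L$ and $T_K\alpha\subseteq T_L\beta$, with rank of $(K,\alpha)$ equal to $|K|$, together with an adjoined least element of rank $-1$. $\Gamma(\mathcal{P}_G)$ denotes the group of order-preserving bijections of $\mathcal{P}_G$. -}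

module Defs where

open import Level using (0ℓ)
open import Data.Nat using (ℕ; _<_; _<?_)
open import Data.Bool using (Bool; true; false)
open import Data.Fin using (Fin; toℕ)
open import Data.Fin.Permutation as P using (Permutation′; _⟨$⟩ʳ_; _⟨$⟩ˡ_; _∘ₚ_; flip; transpose; inverseʳ; inverseˡ)
open import Data.List using (List; []; _∷_; length; filter; allFin; concatMap; map)
open import Data.List.Relation.Unary.All using (All)
open import Data.Product using (Σ; ∃; _×_; _,_; proj₁; proj₂)
open import Data.Empty using (⊥)
open import Data.Unit using (⊤)
open import Relation.Nullary using (¬_)
open import Relation.Binary.PropositionalEquality using (_≡_; refl; sym; trans; cong₂; subst)

-- Permutations of the vertex set {1,…,p}, modelled as Fin p.
-- Product convention: (σ · τ) x = σ (τ x)  (τ applied first).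

Perm : ℕ → Set
Perm p = Permutation′ p

infixl 7 _·_
_·_ : ∀ {p} → Perm p → Perm p → Perm p
σ · τ = τ ∘ₚ σ

_⁻¹ : ∀ {p} → Perm p → Perm p
σ ⁻¹ = flip σ

_≈ₚ_ : ∀ {p} → Perm p → Perm p → Set
_≈ₚ_ = P._≈_

record Graph (p : ℕ) : Set where
  field
    adj     : Fin p → Fin p → Bool
    adj-sym : ∀ i j → adj i j ≡ adj j i
    adj-irr : ∀ i → adj i i ≡ false
open Graph public

edgeList : ∀ {p} → Graph p → List (Fin p × Fin p)
edgeList {p} G =
  filter (λ e → toℕ (proj₁ e) <? toℕ (proj₂ e))
    (filter (λ e → adj G (proj₁ e) (proj₂ e) Data.Bool.≟ true)
      (concatMap (λ i → map (λ j → (i , j)) (allFin p)) (allFin p)))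

numEdges : ∀ {p} → Graph p → ℕ
numEdges G = length (edgeList G)

data Reach {p} (G : Graph p) : Fin p → Fin p → Set where
  here : ∀ {i} → Reach G i i
  step : ∀ {i k j} → adj G i k ≡ true → Reach G k j → Reach G i j

Connected : ∀ {p} → Graph p → Set
Connected {p} G = ∀ (i j : Fin p) → Reach G i j

record GraphAut {p} (G : Graph p) : Set where
  field
    perm     : Perm p
    preserve : ∀ i j → adj G (perm ⟨$⟩ʳ i) (perm ⟨$⟩ʳ j) ≡ adj G i j
open GraphAut public

-- Edge subsets K ⊆ E(G), encoded as symmetric Bool-relations below adj.

record EdgeSet {p} (G : Graph p) : Set where
  field
    mem     : Fin p → Fin p → Bool
    mem-sym : ∀ i j → mem i j ≡ mem j i
    mem-adj : ∀ i j → mem i j ≡ true → adj G i j ≡ true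
open EdgeSet public

_⊆E_ : ∀ {p} {G : Graph p} → EdgeSet G → EdgeSet G → Set
K ⊆E L = ∀ i j → mem K i j ≡ true → mem L i j ≡ true

_≐E_ : ∀ {p} {G : Graph p} → EdgeSet G → EdgeSet G → Set
K ≐E L = ∀ i j → mem K i j ≡ mem L i j

imageE : ∀ {p} {G : Graph p} → GraphAut G → EdgeSet G → EdgeSet G
imageE {G = G} κ K = record
  { mem     = λ i j → mem K (perm κ ⟨$⟩ˡ i) (perm κ ⟨$⟩ˡ j)
  ; mem-sym = λ i j → mem-sym K _ _
  ; mem-adj = λ i j h →
      trans (sym (cong₂ (adj G) (inverseʳ (perm κ)) (inverseʳ (perm κ))))
            (trans (preserve κ _ _) (mem-adj K _ _ h)) }

-- The subgroup T_K = ⟨ τ_e : e ∈ K ⟩ ≤ S_p.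
-- A permutation lies in T_K iff it is a finite product of transpositions
-- τ_e with e ∈ K (empty product = identity; the generators are
-- involutions, so this set is exactly the generated subgroup).

prodT : ∀ {p} → List (Fin p × Fin p) → Fin p → Fin p
prodT []             x = x
prodT ((i , j) ∷ es) x = transpose i j ⟨$⟩ʳ prodT es x

InT : ∀ {p} {G : Graph p} → EdgeSet G → Perm p → Set
InT {p} K σ = Σ (List (Fin p × Fin p)) λ es →
  All (λ e → mem K (proj₁ e) (proj₂ e) ≡ true) es ×
  (∀ x → σ ⟨$⟩ʳ x ≡ prodT es x)

InCoset : ∀ {p} {G : Graph p} → EdgeSet G → Perm p → Perm p → Set
InCoset {p} K α π = Σ (Perm p) λ σ → InT K σ × (π ≈ₚ (σ · α))

CosetSub : ∀ {p} {G : Graph p} → EdgeSet G → Perm p → EdgeSet G → Perm p → Set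
CosetSub {p} K α L β = ∀ (π : Perm p) → InCoset K α π → InCoset L β π

data Elem {p} (G : Graph p) : Set where
  bot  : Elem G
  face : EdgeSet G → Perm p → Elem G

_∼_ : ∀ {p} {G : Graph p} → Elem G → Elem G → Set
bot        ∼ bot        = ⊤
bot        ∼ face _ _   = ⊥
face _ _   ∼ bot        = ⊥
face K α   ∼ face L β   = (K ≐E L) × CosetSub K α L β × CosetSub L β K α

_≤P_ : ∀ {p} {G : Graph p} → Elem G → Elem G → Set
bot        ≤P _          = ⊤
face _ _   ≤P bot        = ⊥
face K α   ≤P face L β   = (K ⊆E L) × CosetSub K α L β

record IsPosetAut {p} (G : Graph p) (f : Elem G → Elem G) : Set where
  field
    f-resp   : ∀ {x y} → x ∼ y → f x ∼ f y
    inv      : Elem G → Elem G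
    inv-resp : ∀ {x y} → x ∼ y → inv x ∼ inv y
    inv-left : ∀ x → inv (f x) ∼ x
    inv-right : ∀ x → f (inv x) ∼ x
    mono     : ∀ {x y} → x ≤P y → f x ≤P f y
    inv-mono : ∀ {x y} → x ≤P y → inv x ≤P inv y

actS : ∀ {p} {G : Graph p} → Perm p → Elem G → Elem G
actS γ bot        = bot
actS γ (face K α) = face K (α · γ)

actG : ∀ {p} {G : Graph p} → GraphAut G → Elem G → Elem G
actG κ bot        = bot
actG κ (face K α) = face (imageE κ K) (perm κ · α · (perm κ ⁻¹))

-- An automorphism f of P_G maps vertices (K = ∅) to vertices and edges (|K| = 1) to edges, which gives
-- a map φ on S_p with f (∅ , α) ∼ (∅ , φ α) and a labelling ℓ of the edges of G with
-- f ({e} , α) ∼ ({ℓ e} , φ α). Looking at the rank-2 faces ({e , g} , α) shows that a labelling valid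
-- at α stays valid at τ_e α and that φ (τ_e α) = τ_{ℓ e} φ α. Since G is connected the τ_e generate S_p,
-- so Φ α = φ α · (φ 1)⁻¹ is an automorphism of S_p sending transpositions to transpositions. For p ≥ 3
-- such an automorphism is conjugation by some κ, and ℓ e = κ(e) makes κ a graph automorphism. Then f and
-- the product of the two actions agree on vertices and edges of P_G, hence everywhere, since a face is
-- determined by the vertices and edges below it. Uniqueness holds because only the identity commutes
-- with every transposition; for p = 2 (q = 1) it fails, S_2 being abelian.

module Submission where

open import Defs
open import Data.Bool as Bool using (Bool; true; false; _∨_)
open import Data.Bool.Properties using (∨-zeroʳ; ¬-not)
open import Data.Empty using (⊥; ⊥-elim)
open import Data.Fin using (Fin; zero; suc; toℕ; fromℕ<; punchOut)
open import Data.Fin.Properties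
  using (_≟_; any?; toℕ-injective; toℕ-fromℕ<; toℕ<n; punchOut-injective; injective⇒≤)
open import Data.Fin.Permutation using (_⟨$⟩ʳ_; _⟨$⟩ˡ_; transpose; inverseʳ; inverseˡ)
import Data.Fin.Permutation as Permutation
import Data.Fin.Permutation.Components as Components
open import Data.List using (List; []; _∷_; _++_; length; filter)
open import Data.List.Properties using (filter-accept; filter-reject)
open import Data.List.Relation.Unary.All as All using (All; []; _∷_)
import Data.List.Relation.Unary.All.Properties as AllP
open import Data.Nat using (ℕ; zero; suc; _+_; _<_; _≤_; _<?_)
open import Data.Nat.Properties using (<⇒≤; <-irrefl; ≤-refl; m<1+n⇒m<n∨m≡n)
open import Data.Product using (Σ; _×_; _,_; proj₁; proj₂)
open import Data.Sum as Sum using (_⊎_; inj₁; inj₂; [_,_]′)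
open import Data.Unit using (tt)
open import Function using (_∘_; id; mk⇔)
open import Relation.Binary.Bundles using (Preorder)
open import Relation.Binary.Structures using (IsPreorder)
import Relation.Binary.Reasoning.Preorder as PreorderReasoning
open import Relation.Binary.PropositionalEquality
open import Relation.Nullary using (¬_; Dec; yes; no; does; contradiction)
open import Relation.Nullary.Decidable using (_×-dec_; _⊎-dec_; does-⇔; dec-true)
open import Relation.Nullary.Irrelevant using (Irrelevant)

private variable p : ℕ

-- Transpositions and the subgroups T_K

tr : Fin p → Fin p → Fin p → Fin p
tr = Components.transpose

τ : Fin p → Fin p → Perm p
τ = transpose

tr-left : (i j : Fin p) → tr i j i ≡ j
tr-left i j with i ≟ i
... | yes _ = refl
... | no i≢i = contradiction refl i≢i

tr-right : (i j : Fin p) → tr i j j ≡ i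
tr-right i j with j ≟ i
... | yes j≡i = j≡i
... | no _ with j ≟ j
...   | yes _ = refl
...   | no j≢j = contradiction refl j≢j

tr-fix : (i j : Fin p) {k : Fin p} → k ≢ i → k ≢ j → tr i j k ≡ k
tr-fix i j {k} k≢i k≢j with k ≟ i
... | yes k≡i = contradiction k≡i k≢i
... | no _ with k ≟ j
...   | yes k≡j = contradiction k≡j k≢j
...   | no _ = refl

data TrView {p} (i j k : Fin p) : Set where
  at-left  : k ≡ i → TrView i j k
  at-right : k ≡ j → TrView i j k
  outside  : k ≢ i → k ≢ j → TrView i j k

trView : (i j k : Fin p) → TrView i j k
trView i j k with k ≟ i | k ≟ j
... | yes k≡i | _       = at-left k≡i
... | no _    | yes k≡j = at-right k≡j
... | no k≢i  | no k≢j  = outside k≢i k≢j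

tr-involutive : (i j : Fin p) → tr i j ∘ tr i j ≗ id
tr-involutive i j k with trView i j k
... | at-left refl  = trans (cong (tr i j) (tr-left i j)) (tr-right i j)
... | at-right refl = trans (cong (tr i j) (tr-right i j)) (tr-left i j)
... | outside k≢i k≢j = trans (cong (tr i j) (tr-fix i j k≢i k≢j)) (tr-fix i j k≢i k≢j)

tr-sym : (i j : Fin p) → tr i j ≗ tr j i
tr-sym i j k with trView i j k
... | at-left refl  = trans (tr-left i j) (sym (tr-right j i))
... | at-right refl = trans (tr-right i j) (sym (tr-left j i))
... | outside k≢i k≢j = trans (tr-fix i j k≢i k≢j) (sym (tr-fix j i k≢j k≢i))

tr-same : (i : Fin p) → tr i i ≗ id
tr-same i k with trView i i k
... | at-left refl  = tr-left i i
... | at-right refl = tr-left i i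
... | outside k≢i _ = tr-fix i i k≢i k≢i

⟨$⟩ʳ-injective : (π : Perm p) {x y : Fin p} → π ⟨$⟩ʳ x ≡ π ⟨$⟩ʳ y → x ≡ y
⟨$⟩ʳ-injective π {x} {y} eq = trans (sym (inverseˡ π)) (trans (cong (π ⟨$⟩ˡ_) eq) (inverseˡ π))

tr-conjugate : (π : Perm p) (i j : Fin p) →
  (λ x → π ⟨$⟩ʳ tr i j (π ⟨$⟩ˡ x)) ≗ tr (π ⟨$⟩ʳ i) (π ⟨$⟩ʳ j)
tr-conjugate π i j x with trView (π ⟨$⟩ʳ i) (π ⟨$⟩ʳ j) x
... | at-left refl =
  trans (cong (λ z → π ⟨$⟩ʳ tr i j z) (inverseˡ π))
        (trans (cong (π ⟨$⟩ʳ_) (tr-left i j)) (sym (tr-left (π ⟨$⟩ʳ i) (π ⟨$⟩ʳ j))))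
... | at-right refl =
  trans (cong (λ z → π ⟨$⟩ʳ tr i j z) (inverseˡ π))
        (trans (cong (π ⟨$⟩ʳ_) (tr-right i j)) (sym (tr-right (π ⟨$⟩ʳ i) (π ⟨$⟩ʳ j))))
... | outside x≢πi x≢πj =
  trans (cong (π ⟨$⟩ʳ_) (tr-fix i j (x≢πi ∘ moved) (x≢πj ∘ moved)))
        (trans (inverseʳ π) (sym (tr-fix _ _ x≢πi x≢πj)))
  where
  moved : ∀ {k} → π ⟨$⟩ˡ x ≡ k → x ≡ π ⟨$⟩ʳ k
  moved eq = trans (sym (inverseʳ π)) (cong (π ⟨$⟩ʳ_) eq)

tr-conjugate-tr : (w a b : Fin p) → a ≢ w → b ≢ w → a ≢ b → tr w a ∘ tr w b ∘ tr w a ≗ tr a b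
tr-conjugate-tr w a b a≢w b≢w a≢b x =
  trans (cong (tr w a ∘ tr w b) (tr-sym w a x))
        (trans (tr-conjugate (τ w a) w b x)
               (cong₂ (λ u v → tr u v x) (tr-left w a) (tr-fix w a b≢w (a≢b ∘ sym))))

tr-disjoint-comm : (a b c d : Fin p) → c ≢ a → c ≢ b → d ≢ a → d ≢ b →
  tr a b ∘ tr c d ≗ tr c d ∘ tr a b
tr-disjoint-comm a b c d c≢a c≢b d≢a d≢b x =
  trans (cong (tr a b ∘ tr c d) (sym (inverseˡ (τ a b) {x})))
        (trans (tr-conjugate (τ a b) c d (tr a b x))
               (cong₂ (λ u v → tr u v (tr a b x)) (tr-fix a b c≢a c≢b) (tr-fix a b d≢a d≢b)))

τ-noncommuting : (v a b : Fin p) → a ≢ v → b ≢ v → a ≢ b → ¬ (τ v a · τ v b) ≈ₚ (τ v b · τ v a)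
τ-noncommuting v a b a≢v b≢v a≢b comm = a≢b (begin
  a                ≡⟨ tr-fix v b a≢v a≢b ⟨
  tr v b a         ≡⟨ cong (tr v b) (tr-left v a) ⟨
  tr v b (tr v a v) ≡⟨ comm v ⟨
  tr v a (tr v b v) ≡⟨ cong (tr v a) (tr-left v b) ⟩
  tr v a b         ≡⟨ tr-fix v a b≢v (a≢b ∘ sym) ⟩
  b                ∎)
  where open ≡-Reasoning

SamePair : (a b c d : Fin p) → Set
SamePair a b c d = (a ≡ c × b ≡ d) ⊎ (a ≡ d × b ≡ c)

samePair? : (a b c d : Fin p) → Dec (SamePair a b c d)
samePair? a b c d = (a ≟ c ×-dec b ≟ d) ⊎-dec (a ≟ d ×-dec b ≟ c)

module _ {a b c d : Fin p} where

  samePair-sym : SamePair a b c d → SamePair c d a b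
  samePair-sym (inj₁ (refl , refl)) = inj₁ (refl , refl)
  samePair-sym (inj₂ (refl , refl)) = inj₂ (refl , refl)

  samePair-swap : SamePair a b c d → SamePair b a c d
  samePair-swap (inj₁ (refl , refl)) = inj₂ (refl , refl)
  samePair-swap (inj₂ (refl , refl)) = inj₁ (refl , refl)

  tr-cong : SamePair a b c d → tr a b ≗ tr c d
  tr-cong (inj₁ (refl , refl)) x = refl
  tr-cong (inj₂ (refl , refl)) x = tr-sym a b x

  samePair-injective : (g : Fin p → Fin p) → (∀ {x y} → g x ≡ g y → x ≡ y) →
    SamePair (g a) (g b) (g c) (g d) → SamePair a b c d
  samePair-injective g inj (inj₁ (ac , bd)) = inj₁ (inj ac , inj bd)
  samePair-injective g inj (inj₂ (ad , bc)) = inj₂ (inj ad , inj bc)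

  samePair-map : (g : Fin p → Fin p) → SamePair a b c d → SamePair (g a) (g b) (g c) (g d)
  samePair-map g (inj₁ (refl , refl)) = inj₁ (refl , refl)
  samePair-map g (inj₂ (refl , refl)) = inj₂ (refl , refl)

  samePair-of-members : a ≢ b → (a ≡ c ⊎ a ≡ d) → (b ≡ c ⊎ b ≡ d) → SamePair a b c d
  samePair-of-members a≢b (inj₁ refl) (inj₁ refl) = contradiction refl a≢b
  samePair-of-members a≢b (inj₁ refl) (inj₂ refl) = inj₁ (refl , refl)
  samePair-of-members a≢b (inj₂ refl) (inj₁ refl) = inj₂ (refl , refl)
  samePair-of-members a≢b (inj₂ refl) (inj₂ refl) = contradiction refl a≢b

samePair-trans : {a b c d e f : Fin p} → SamePair a b c d → SamePair c d e f → SamePair a b e f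
samePair-trans (inj₁ (refl , refl)) cd~ef = cd~ef
samePair-trans (inj₂ (refl , refl)) cd~ef = samePair-swap cd~ef

samePair-refl : (a b : Fin p) → SamePair a b a b
samePair-refl a b = inj₁ (refl , refl)

tr-injective : (i j c d : Fin p) → i ≢ j → tr i j ≗ tr c d → SamePair i j c d
tr-injective i j c d i≢j eq with trView c d i
... | at-left i≡c  = inj₁ (i≡c , trans (sym (tr-left i j)) (trans (eq i) (trans (cong (tr c d) i≡c) (tr-left c d))))
... | at-right i≡d = inj₂ (i≡d , trans (sym (tr-left i j)) (trans (eq i) (trans (cong (tr c d) i≡d) (tr-right c d))))
... | outside i≢c i≢d = contradiction (sym (trans (sym (tr-left i j)) (trans (eq i) (tr-fix c d i≢c i≢d)))) i≢j

⁻¹-cong : (σ ρ : Perm p) → σ ≈ₚ ρ → (σ ⁻¹) ≈ₚ (ρ ⁻¹)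
⁻¹-cong σ ρ σ≈ρ x =
  ⟨$⟩ʳ-injective ρ (trans (sym (σ≈ρ (σ ⟨$⟩ˡ x))) (trans (inverseʳ σ) (sym (inverseʳ ρ))))

conjugate : Perm p → Perm p → Perm p
conjugate π α = π · α · π ⁻¹

conj-τ : (π : Perm p) (i j : Fin p) (σ : Perm p) →
  conjugate π (τ i j · σ) ≈ₚ (τ (π ⟨$⟩ʳ i) (π ⟨$⟩ʳ j) · conjugate π σ)
conj-τ π i j σ x =
  trans (cong (λ y → π ⟨$⟩ʳ tr i j y) (sym (inverseˡ π))) (tr-conjugate π i j _)

τ·-moves : (i j : Fin p) (α : Perm p) → i ≢ j → ¬ (τ i j · α) ≈ₚ α
τ·-moves i j α i≢j τα≈α = i≢j (sym (begin
  j                        ≡⟨ tr-left i j ⟨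
  tr i j i                 ≡⟨ cong (tr i j) (inverseʳ α) ⟨
  tr i j (α ⟨$⟩ʳ (α ⟨$⟩ˡ i)) ≡⟨ τα≈α (α ⟨$⟩ˡ i) ⟩
  α ⟨$⟩ʳ (α ⟨$⟩ˡ i)          ≡⟨ inverseʳ α ⟩
  i                        ∎))
  where open ≡-Reasoning

moving-pair : (i j a b : Fin p) → i ≢ j → a ≢ b →
  Σ (Perm p) λ π → π ⟨$⟩ʳ i ≡ a × π ⟨$⟩ʳ j ≡ b
moving-pair i j a b i≢j a≢b =
  τ j′ b · τ i a , trans (cong (tr j′ b) (tr-left i a)) (tr-fix j′ b a≢j′ a≢b) , tr-left j′ b
  where
  j′ = tr i a j
  a≢j′ : a ≢ j′
  a≢j′ a≡j′ = i≢j (sym (trans (sym (tr-involutive i a j)) (trans (cong (tr i a) (sym a≡j′)) (tr-right i a))))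

Word : ℕ → Set
Word p = List (Fin p × Fin p)

permW : Word p → Perm p
permW []            = Permutation.id
permW ((i , j) ∷ w) = τ i j · permW w

permW-prodT : (w : Word p) → (permW w ⟨$⟩ʳ_) ≗ prodT w
permW-prodT []            x = refl
permW-prodT ((i , j) ∷ w) x = cong (tr i j) (permW-prodT w x)

adjacent⇒≢ : {G : Graph p} {i j : Fin p} → adj G i j ≡ true → i ≢ j
adjacent⇒≢ {G = G} {j = j} i~j refl with trans (sym i~j) (adj-irr G j)
... | ()

record Edge {p} (G : Graph p) : Set where
  constructor mkEdge
  field
    end₁ end₂ : Fin p
    adjacent  : adj G end₁ end₂ ≡ true
open Edge public

∨-true : (a b : Bool) → a ∨ b ≡ true → a ≡ true ⊎ b ≡ true
∨-true true  b _  = inj₁ refl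
∨-true false b ab = inj₂ ab

does-true : {A : Set} (a? : Dec A) → does a? ≡ true → A
does-true (yes a) _ = a

adjacent-samePair : (G : Graph p) {a b c d : Fin p} → SamePair a b c d → adj G a b ≡ true → adj G c d ≡ true
adjacent-samePair G (inj₁ (refl , refl)) a~b = a~b
adjacent-samePair G (inj₂ (refl , refl)) a~b = trans (adj-sym G _ _) a~b

module _ {G : Graph p} where

  AllIn : EdgeSet G → Word p → Set
  AllIn K = All (λ e → mem K (proj₁ e) (proj₂ e) ≡ true)

  module _ (K : EdgeSet G) where

    InT-resp : (σ ρ : Perm p) → σ ≈ₚ ρ → InT K σ → InT K ρ
    InT-resp σ ρ σ≈ρ (w , w∈K , σ≗w) = w , w∈K , λ x → trans (sym (σ≈ρ x)) (σ≗w x)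

    InT-id : InT K Permutation.id
    InT-id = [] , [] , λ _ → refl

    InT-τ : (i j : Fin p) → mem K i j ≡ true → InT K (τ i j)
    InT-τ i j ij∈K = (i , j) ∷ [] , ij∈K ∷ [] , λ _ → refl

    InT-· : (σ ρ : Perm p) → InT K σ → InT K ρ → InT K (σ · ρ)
    InT-· σ ρ (w , w∈K , σ≗w) (v , v∈K , ρ≗v) =
      w ++ v , AllP.++⁺ w∈K v∈K ,
      λ x → trans (σ≗w _) (trans (cong (prodT w) (ρ≗v x)) (sym (prodT-++ w v x)))
      where
      prodT-++ : (w v : Word p) (x : Fin p) → prodT (w ++ v) x ≡ prodT w (prodT v x)
      prodT-++ []            v x = refl
      prodT-++ ((i , j) ∷ w) v x = cong (tr i j) (prodT-++ w v x)

    InT-elim : (P : Perm p → Set) → (∀ σ ρ → σ ≈ₚ ρ → P σ → P ρ) → P Permutation.id →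
      (∀ i j σ → mem K i j ≡ true → P σ → P (τ i j · σ)) →
      ∀ σ → InT K σ → P σ
    InT-elim P P-resp P-id P-step σ (w , w∈K , σ≗w) =
      P-resp (permW w) σ (λ x → trans (permW-prodT w x) (sym (σ≗w x))) (onWords w w∈K)
      where
      onWords : (w : Word p) → AllIn K w → P (permW w)
      onWords []            []           = P-id
      onWords ((i , j) ∷ w) (ij∈K ∷ w∈K) = P-step i j (permW w) ij∈K (onWords w w∈K)

    InT-⁻¹ : (σ : Perm p) → InT K σ → InT K (σ ⁻¹)
    InT-⁻¹ = InT-elim (λ σ → InT K (σ ⁻¹))
      (λ σ ρ σ≈ρ → InT-resp (σ ⁻¹) (ρ ⁻¹) (⁻¹-cong σ ρ σ≈ρ)) InT-id
      (λ i j σ ij∈K σ⁻¹∈K → InT-· (σ ⁻¹) (τ j i) σ⁻¹∈K (InT-τ j i (trans (mem-sym K j i) ij∈K)))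

    InT-mono : (L : EdgeSet G) (σ : Perm p) → K ⊆E L → InT K σ → InT L σ
    InT-mono L σ K⊆L (w , w∈K , σ≗w) = w , All.map (λ {e} → K⊆L (proj₁ e) (proj₂ e)) w∈K , σ≗w

  InT-conj : (K : EdgeSet G) (κ : GraphAut G) (σ : Perm p) → InT K σ → InT (imageE κ K) (conjugate (perm κ) σ)
  InT-conj K κ = InT-elim K (λ σ → InT κK (conjugate κ′ σ))
    (λ σ ρ σ≈ρ → InT-resp κK (conjugate κ′ σ) (conjugate κ′ ρ) (λ x → cong (κ′ ⟨$⟩ʳ_) (σ≈ρ _)))
    (InT-resp κK Permutation.id (conjugate κ′ Permutation.id) (λ x → sym (inverseʳ κ′)) (InT-id κK))
    (λ i j σ ij∈K κσκ⁻¹∈κK →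
      InT-resp κK (τ (κ′ ⟨$⟩ʳ i) (κ′ ⟨$⟩ʳ j) · conjugate κ′ σ) (conjugate κ′ (τ i j · σ))
        (λ x → sym (conj-τ κ′ i j σ x))
        (InT-· κK (τ (κ′ ⟨$⟩ʳ i) (κ′ ⟨$⟩ʳ j)) (conjugate κ′ σ)
          (InT-τ κK (κ′ ⟨$⟩ʳ i) (κ′ ⟨$⟩ʳ j) (trans (cong₂ (mem K) (inverseˡ κ′) (inverseˡ κ′)) ij∈K))
          κσκ⁻¹∈κK))
    where
    κ′ = perm κ
    κK = imageE κ K

  -- T_K α = T_K β
  SameCoset : EdgeSet G → Perm p → Perm p → Set
  SameCoset K α β = InT K (α · β ⁻¹)

  module _ (K : EdgeSet G) where

    ≈⇒sameCoset : (α β : Perm p) → α ≈ₚ β → SameCoset K α β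
    ≈⇒sameCoset α β α≈β =
      InT-resp K Permutation.id (α · β ⁻¹) (λ x → sym (trans (α≈β _) (inverseʳ β))) (InT-id K)

    sameCoset-refl : (α : Perm p) → SameCoset K α α
    sameCoset-refl α = ≈⇒sameCoset α α (λ _ → refl)

    sameCoset-sym : (α β : Perm p) → SameCoset K α β → SameCoset K β α
    sameCoset-sym α β = InT-⁻¹ K (α · β ⁻¹)

    sameCoset-trans : (α β γ : Perm p) → SameCoset K α β → SameCoset K β γ → SameCoset K α γ
    sameCoset-trans α β γ αβ βγ = InT-resp K ((α · β ⁻¹) · (β · γ ⁻¹)) (α · γ ⁻¹)
      (λ x → cong (α ⟨$⟩ʳ_) (inverseˡ β)) (InT-· K (α · β ⁻¹) (β · γ ⁻¹) αβ βγ)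

    sameCoset-mono : (L : EdgeSet G) (α β : Perm p) → K ⊆E L → SameCoset K α β → SameCoset L α β
    sameCoset-mono L α β K⊆L = InT-mono K L (α · β ⁻¹) K⊆L

    sameCoset-·ʳ : (α β γ : Perm p) → SameCoset K α β → SameCoset K (α · γ) (β · γ)
    sameCoset-·ʳ α β γ = InT-resp K (α · β ⁻¹) ((α · γ) · (β · γ) ⁻¹)
      (λ x → cong (α ⟨$⟩ʳ_) (sym (inverseʳ γ)))

    sameCoset-τ : (i j : Fin p) → mem K i j ≡ true → (α : Perm p) → SameCoset K (τ i j · α) α
    sameCoset-τ i j ij∈K α = InT-resp K (τ i j) (τ i j · α · α ⁻¹)
      (λ x → cong (tr i j) (sym (inverseʳ α))) (InT-τ K i j ij∈K)

  sameCoset-conj : (K : EdgeSet G) (κ : GraphAut G) (α β : Perm p) → SameCoset K α β →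
    SameCoset (imageE κ K) (conjugate (perm κ) α) (conjugate (perm κ) β)
  sameCoset-conj K κ α β αβ = InT-resp (imageE κ K) (conjugate κ′ (α · β ⁻¹))
    (conjugate κ′ α · conjugate κ′ β ⁻¹)
    (λ x → cong (λ y → κ′ ⟨$⟩ʳ (α ⟨$⟩ʳ y)) (sym (inverseˡ κ′)))
    (InT-conj K κ (α · β ⁻¹) αβ)
    where κ′ = perm κ

  end₁≢end₂ : (e : Edge G) → end₁ e ≢ end₂ e
  end₁≢end₂ e = adjacent⇒≢ {G = G} (adjacent e)

  _∈E_ : Edge G → EdgeSet G → Set
  e ∈E K = mem K (end₁ e) (end₂ e) ≡ true

  SameEdge : Edge G → Edge G → Set
  SameEdge e e′ = SamePair (end₁ e) (end₂ e) (end₁ e′) (end₂ e′)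

  τₑ : Edge G → Perm p
  τₑ e = τ (end₁ e) (end₂ e)

  edgeIn : (K : EdgeSet G) (i j : Fin p) → mem K i j ≡ true → Edge G
  edgeIn K i j ij∈K = mkEdge i j (mem-adj K i j ij∈K)

  IsEmptyE : EdgeSet G → Set
  IsEmptyE K = ∀ i j → mem K i j ≡ false

  ∅E : EdgeSet G
  ∅E = record { mem = λ _ _ → false ; mem-sym = λ _ _ → refl ; mem-adj = λ _ _ () }

  fullE : EdgeSet G
  fullE = record { mem = adj G ; mem-sym = adj-sym G ; mem-adj = λ _ _ i~j → i~j }

  _∪E_ : EdgeSet G → EdgeSet G → EdgeSet G
  K ∪E L = record
    { mem     = λ i j → mem K i j ∨ mem L i j
    ; mem-sym = λ i j → cong₂ _∨_ (mem-sym K i j) (mem-sym L i j)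
    ; mem-adj = λ i j ij∈K∪L → [ mem-adj K i j , mem-adj L i j ]′ (∨-true _ _ ij∈K∪L) }

  singleE : Edge G → EdgeSet G
  singleE e = record
    { mem     = λ i j → does (samePair? i j (end₁ e) (end₂ e))
    ; mem-sym = λ i j → does-⇔ (mk⇔ samePair-swap samePair-swap) (samePair? i j _ _) (samePair? j i _ _)
    ; mem-adj = λ i j ij∈e → adjacent-pair (does-true (samePair? i j _ _) ij∈e) }
    where
    adjacent-pair : ∀ {i j} → SamePair i j (end₁ e) (end₂ e) → adj G i j ≡ true
    adjacent-pair (inj₁ (refl , refl)) = adjacent e
    adjacent-pair (inj₂ (refl , refl)) = trans (adj-sym G _ _) (adjacent e)

  emptyE? : (K : EdgeSet G) → Σ (Edge G) (_∈E K) ⊎ IsEmptyE K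
  emptyE? K with any? (λ i → any? (λ j → mem K i j Bool.≟ true))
  ... | yes (i , j , ij∈K) = inj₁ (edgeIn K i j ij∈K , ij∈K)
  ... | no none            = inj₂ λ i j → ¬-not (λ ij∈K → none (i , j , ij∈K))

  ⊆E-antisym : (K L : EdgeSet G) → K ⊆E L → L ⊆E K → K ≐E L
  ⊆E-antisym K L K⊆L L⊆K i j with mem K i j in ij∈K
  ... | true  = sym (K⊆L i j ij∈K)
  ... | false = sym (¬-not (λ ij∈L → case (trans (sym (L⊆K i j ij∈L)) ij∈K)))
    where case : true ≡ false → ⊥
          case ()

  module _ (e : Edge G) where

    ∈singleE⇒samePair : (i j : Fin p) → mem (singleE e) i j ≡ true → SamePair i j (end₁ e) (end₂ e)
    ∈singleE⇒samePair i j = does-true (samePair? i j _ _)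

    ∈singleE : e ∈E singleE e
    ∈singleE = dec-true (samePair? (end₁ e) (end₂ e) (end₁ e) (end₂ e)) (samePair-refl (end₁ e) (end₂ e))

    singleE-⊆ : (K : EdgeSet G) → e ∈E K → singleE e ⊆E K
    singleE-⊆ K e∈K i j ij∈e with ∈singleE⇒samePair i j ij∈e
    ... | inj₁ (refl , refl) = e∈K
    ... | inj₂ (refl , refl) = trans (mem-sym K _ _) e∈K

    ⊆-singleE : (K : EdgeSet G) (e′ : Edge G) → K ⊆E singleE e → e′ ∈E K → K ≐E singleE e
    ⊆-singleE K e′ K⊆e e′∈K =
      ⊆E-antisym K (singleE e) K⊆e (singleE-⊆ K (subst (_≡ true) (sameMem (K⊆e _ _ e′∈K)) e′∈K))
      where
      sameMem : mem (singleE e) (end₁ e′) (end₂ e′) ≡ true → mem K (end₁ e′) (end₂ e′) ≡ mem K (end₁ e) (end₂ e)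
      sameMem e′∈e with ∈singleE⇒samePair _ _ e′∈e
      ... | inj₁ (p₁ , p₂) = cong₂ (mem K) p₁ p₂
      ... | inj₂ (p₁ , p₂) = trans (cong₂ (mem K) p₁ p₂) (mem-sym K _ _)

  singleE-injective : (e e′ : Edge G) → singleE e ≐E singleE e′ → SameEdge e e′
  singleE-injective e e′ e≐e′ = ∈singleE⇒samePair e′ (end₁ e) (end₂ e) (trans (sym (e≐e′ (end₁ e) (end₂ e))) (∈singleE e))

  singleE-cong : (e e′ : Edge G) → SameEdge e e′ → singleE e ≐E singleE e′
  singleE-cong e e′ e~e′ i j =
    does-⇔ (mk⇔ (λ ij~e → samePair-trans ij~e e~e′) (λ ij~e′ → samePair-trans ij~e′ (samePair-sym e~e′)))
      (samePair? i j (end₁ e) (end₂ e)) (samePair? i j (end₁ e′) (end₂ e′))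

  imageE-singleE : (κ : GraphAut G) (e e′ : Edge G) →
    SamePair (end₁ e′) (end₂ e′) (perm κ ⟨$⟩ʳ end₁ e) (perm κ ⟨$⟩ʳ end₂ e) → singleE e′ ≐E imageE κ (singleE e)
  imageE-singleE κ e e′ e′~κe i j =
    does-⇔ (mk⇔ (λ ij~e′ → subst₂ (λ u v → SamePair _ _ u v) (inverseˡ κ′) (inverseˡ κ′)
                              (samePair-map (κ′ ⟨$⟩ˡ_) (samePair-trans ij~e′ e′~κe)))
                (λ κ⁻¹ij~e → samePair-trans (subst₂ (λ u v → SamePair u v _ _) (inverseʳ κ′) (inverseʳ κ′)
                                               (samePair-map (κ′ ⟨$⟩ʳ_) κ⁻¹ij~e))
                                            (samePair-sym e′~κe)))
      (samePair? i j (end₁ e′) (end₂ e′)) (samePair? (κ′ ⟨$⟩ˡ i) (κ′ ⟨$⟩ˡ j) (end₁ e) (end₂ e))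
    where κ′ = perm κ

  ∈singleE⇒≐E : (e e′ : Edge G) → e′ ∈E singleE e → singleE e′ ≐E singleE e
  ∈singleE⇒≐E e e′ e′∈e = singleE-cong e′ e (∈singleE⇒samePair e _ _ e′∈e)

  ⊆-∪ˡ : (K L : EdgeSet G) → K ⊆E (K ∪E L)
  ⊆-∪ˡ K L i j ij∈K = cong (_∨ mem L i j) ij∈K

  ⊆-∪ʳ : (K L : EdgeSet G) → L ⊆E (K ∪E L)
  ⊆-∪ʳ K L i j ij∈L = trans (cong (mem K i j ∨_) ij∈L) (∨-zeroʳ (mem K i j))

  ∪-least : (K L M : EdgeSet G) → K ⊆E M → L ⊆E M → (K ∪E L) ⊆E M
  ∪-least K L M K⊆M L⊆M i j ij∈K∪L = [ K⊆M i j , L⊆M i j ]′ (∨-true _ _ ij∈K∪L)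

  InT-∅ : (K : EdgeSet G) → IsEmptyE K → (σ : Perm p) → InT K σ → σ ≈ₚ Permutation.id
  InT-∅ K K-empty = InT-elim K (λ σ → σ ≈ₚ Permutation.id)
    (λ σ ρ σ≈ρ σ≈id x → trans (sym (σ≈ρ x)) (σ≈id x)) (λ _ → refl)
    (λ i j σ ij∈K _ → contradiction (trans (sym ij∈K) (K-empty i j)) λ ())

  sameCoset-∅ : (K : EdgeSet G) → IsEmptyE K → (α β : Perm p) → SameCoset K α β → α ≈ₚ β
  sameCoset-∅ K K-empty α β αβ x =
    trans (cong (α ⟨$⟩ʳ_) (sym (inverseˡ β))) (InT-∅ K K-empty (α · β ⁻¹) αβ (β ⟨$⟩ʳ x))

  InT-singleE : (e : Edge G) (σ : Perm p) → InT (singleE e) σ → σ ≈ₚ Permutation.id ⊎ σ ≈ₚ τₑ e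
  InT-singleE e = InT-elim (singleE e) (λ σ → σ ≈ₚ Permutation.id ⊎ σ ≈ₚ τₑ e)
    (λ σ ρ σ≈ρ → Sum.map (λ σ≈ x → trans (sym (σ≈ρ x)) (σ≈ x)) (λ σ≈ x → trans (sym (σ≈ρ x)) (σ≈ x)))
    (inj₁ (λ _ → refl))
    multiply
    where
    multiply : ∀ i j σ → mem (singleE e) i j ≡ true → σ ≈ₚ Permutation.id ⊎ σ ≈ₚ τₑ e →
      (τ i j · σ) ≈ₚ Permutation.id ⊎ (τ i j · σ) ≈ₚ τₑ e
    multiply i j σ ij∈e (inj₁ σ≈id) = inj₂ λ x →
      trans (cong (tr i j) (σ≈id x)) (tr-cong (∈singleE⇒samePair e i j ij∈e) x)
    multiply i j σ ij∈e (inj₂ σ≈τₑ) = inj₁ λ x →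
      trans (cong (tr i j) (σ≈τₑ x))
            (trans (tr-cong (∈singleE⇒samePair e i j ij∈e) (tr (end₁ e) (end₂ e) x)) (tr-involutive (end₁ e) (end₂ e) x))

  sameCoset-singleE : (e : Edge G) (α β : Perm p) → SameCoset (singleE e) α β → α ≈ₚ β ⊎ α ≈ₚ (τₑ e · β)
  sameCoset-singleE e α β αβ =
    Sum.map (λ αβ⁻¹≈ x → trans (unshift x) (αβ⁻¹≈ (β ⟨$⟩ʳ x)))
                 (λ αβ⁻¹≈ x → trans (unshift x) (αβ⁻¹≈ (β ⟨$⟩ʳ x)))
                 (InT-singleE e (α · β ⁻¹) αβ)
    where
    unshift : ∀ x → α ⟨$⟩ʳ x ≡ (α · β ⁻¹) ⟨$⟩ʳ (β ⟨$⟩ʳ x)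
    unshift x = cong (α ⟨$⟩ʳ_) (sym (inverseˡ β))

  InT-reach : {a b : Fin p} → Reach G a b → InT fullE (τ a b)
  InT-reach {a} here = InT-resp fullE Permutation.id (τ a a) (λ x → sym (tr-same a x)) (InT-id fullE)
  InT-reach {a} {b} (step {k = k} a~k k⇝b) with a ≟ b | k ≟ b
  ... | yes refl | _ = InT-resp fullE Permutation.id (τ a a) (λ x → sym (tr-same a x)) (InT-id fullE)
  ... | no _ | yes refl = InT-τ fullE a k a~k
  ... | no a≢b | no k≢b =
    InT-resp fullE (τ k a · τ k b · τ k a) (τ a b)
      (tr-conjugate-tr k a b (adjacent⇒≢ {G = G} a~k) (k≢b ∘ sym) a≢b)
      (InT-· fullE (τ k a · τ k b) (τ k a) (InT-· fullE (τ k a) (τ k b) k~a (InT-reach k⇝b)) k~a)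
    where
    k~a : InT fullE (τ k a)
    k~a = InT-τ fullE k a (trans (adj-sym G k a) a~k)

  InT-of-transpositions : (K : EdgeSet G) → (∀ a b → InT K (τ a b)) → (α : Perm p) → InT K α
  InT-of-transpositions K τ∈K α =
    InT-resp K (σ ⁻¹) α (λ x → trans (cong (σ ⟨$⟩ˡ_) (sym (σα-fixes x (toℕ<n x)))) (inverseˡ σ))
      (InT-⁻¹ K σ σ∈K)
    where
    -- selection sort: after m steps σ · α fixes the first m points
    sortPrefix : (m : ℕ) → m ≤ p →
      Σ (Perm p) λ σ → InT K σ × (∀ x → toℕ x < m → σ ⟨$⟩ʳ (α ⟨$⟩ʳ x) ≡ x)
    sortPrefix zero    _   = Permutation.id , InT-id K , λ _ ()
    sortPrefix (suc m) m<p with sortPrefix m (<⇒≤ m<p)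
    ... | σ , σ∈K , fixes = τ x₀ y · σ , InT-· K (τ x₀ y) σ (τ∈K x₀ y) σ∈K , fixes′
      where
      x₀ = fromℕ< m<p
      y  = σ ⟨$⟩ʳ (α ⟨$⟩ʳ x₀)
      fixes′ : ∀ x → toℕ x < suc m → tr x₀ y (σ ⟨$⟩ʳ (α ⟨$⟩ʳ x)) ≡ x
      fixes′ x x<1+m with m<1+n⇒m<n∨m≡n x<1+m
      ... | inj₁ x<m = trans (cong (tr x₀ y) (fixes x x<m)) (tr-fix x₀ y x≢x₀ x≢y)
        where
        x≢x₀ : x ≢ x₀
        x≢x₀ x≡x₀ = <-irrefl (trans (cong toℕ x≡x₀) (toℕ-fromℕ< m<p)) x<m
        x≢y : x ≢ y
        x≢y x≡y = x≢x₀ (⟨$⟩ʳ-injective α (⟨$⟩ʳ-injective σ (trans (fixes x x<m) x≡y)))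
      ... | inj₂ x≡m with toℕ-injective (trans x≡m (sym (toℕ-fromℕ< m<p)))
      ...   | refl = tr-right x₀ y
    σ = proj₁ (sortPrefix p ≤-refl)
    σ∈K = proj₁ (proj₂ (sortPrefix p ≤-refl))
    σα-fixes = proj₂ (proj₂ (sortPrefix p ≤-refl))

  InT-connected : Connected G → (α : Perm p) → InT fullE α
  InT-connected connected = InT-of-transpositions fullE (λ a b → InT-reach (connected a b))

-- The graphicahedron as a preorder

module _ {G : Graph p} where

  ≐E-sym : (K L : EdgeSet G) → K ≐E L → L ≐E K
  ≐E-sym K L K≐L i j = sym (K≐L i j)

  ≐E⇒⊆E : (K L : EdgeSet G) → K ≐E L → K ⊆E L
  ≐E⇒⊆E K L K≐L i j ij∈K = trans (sym (K≐L i j)) ij∈K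

  cosetSub-intro : (K L : EdgeSet G) (α β : Perm p) → K ⊆E L → SameCoset L α β → CosetSub K α L β
  cosetSub-intro K L α β K⊆L αβ π (σ , σ∈K , π≈σα) =
    σ · (α · β ⁻¹) , InT-· L σ (α · β ⁻¹) (InT-mono K L σ K⊆L σ∈K) αβ ,
    λ x → trans (π≈σα x) (cong (λ y → σ ⟨$⟩ʳ (α ⟨$⟩ʳ y)) (sym (inverseˡ β)))

  cosetSub-elim : (K L : EdgeSet G) (α β : Perm p) → CosetSub K α L β → SameCoset L α β
  cosetSub-elim K L α β αK⊆βL with αK⊆βL α (Permutation.id , InT-id K , λ _ → refl)
  ... | σ , σ∈L , α≈σβ = InT-resp L σ (α · β ⁻¹)
    (λ x → sym (trans (α≈σβ _) (cong (σ ⟨$⟩ʳ_) (inverseʳ β)))) σ∈L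

  face-∼ : (K L : EdgeSet G) (α β : Perm p) → K ≐E L → SameCoset L α β → face K α ∼ face L β
  face-∼ K L α β K≐L αβ =
    K≐L , cosetSub-intro K L α β (≐E⇒⊆E K L K≐L) αβ ,
    cosetSub-intro L K β α (≐E⇒⊆E L K L≐K) (sameCoset-mono L K β α (≐E⇒⊆E L K L≐K) (sameCoset-sym L α β αβ))
    where L≐K = ≐E-sym K L K≐L

  face-≤ : (K L : EdgeSet G) (α β : Perm p) → K ⊆E L → SameCoset L α β → face K α ≤P face L β
  face-≤ K L α β K⊆L αβ = K⊆L , cosetSub-intro K L α β K⊆L αβ

  ∼⇒≐E : (K L : EdgeSet G) (α β : Perm p) → face K α ∼ face L β → K ≐E L
  ∼⇒≐E K L α β (K≐L , _ , _) = K≐L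

  ∼⇒sameCoset : (K L : EdgeSet G) (α β : Perm p) → face K α ∼ face L β → SameCoset L α β
  ∼⇒sameCoset K L α β (_ , αK⊆βL , _) = cosetSub-elim K L α β αK⊆βL

  ≤⇒⊆E : (K L : EdgeSet G) (α β : Perm p) → face K α ≤P face L β → K ⊆E L
  ≤⇒⊆E K L α β (K⊆L , _) = K⊆L

  ≤⇒sameCoset : (K L : EdgeSet G) (α β : Perm p) → face K α ≤P face L β → SameCoset L α β
  ≤⇒sameCoset K L α β (_ , αK⊆βL) = cosetSub-elim K L α β αK⊆βL

  ∼-refl : {x : Elem G} → x ∼ x
  ∼-refl {bot}      = tt
  ∼-refl {face K α} = (λ _ _ → refl) , (λ _ π∈αK → π∈αK) , (λ _ π∈αK → π∈αK)

  ∼-sym : {x y : Elem G} → x ∼ y → y ∼ x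
  ∼-sym {bot}      {bot}      _                 = tt
  ∼-sym {face K α} {face L β} (K≐L , αK⊆βL , βL⊆αK) = ≐E-sym K L K≐L , βL⊆αK , αK⊆βL

  ∼-trans : {x y z : Elem G} → x ∼ y → y ∼ z → x ∼ z
  ∼-trans {bot}      {bot}      {bot}      _ _ = tt
  ∼-trans {face K α} {face L β} {face M γ} (K≐L , αK⊆βL , βL⊆αK) (L≐M , βL⊆γM , γM⊆βL) =
    (λ i j → trans (K≐L i j) (L≐M i j)) , (λ π → βL⊆γM π ∘ αK⊆βL π) , (λ π → βL⊆αK π ∘ γM⊆βL π)

  ∼⇒≤P : {x y : Elem G} → x ∼ y → x ≤P y
  ∼⇒≤P {bot}      {_}        _                  = tt
  ∼⇒≤P {face K α} {face L β} (K≐L , αK⊆βL , _) = ≐E⇒⊆E K L K≐L , αK⊆βL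

  ≤P-trans : {x y z : Elem G} → x ≤P y → y ≤P z → x ≤P z
  ≤P-trans {bot}      {_}        {_}        _ _ = tt
  ≤P-trans {face K α} {face L β} {face M γ} (K⊆L , αK⊆βL) (L⊆M , βL⊆γM) =
    (λ i j → L⊆M i j ∘ K⊆L i j) , (λ π → βL⊆γM π ∘ αK⊆βL π)

  ≤P-isPreorder : IsPreorder (_∼_ {G = G}) _≤P_
  ≤P-isPreorder = record
    { isEquivalence = record { refl = ∼-refl ; sym = ∼-sym ; trans = ∼-trans }
    ; reflexive     = ∼⇒≤P
    ; trans         = ≤P-trans }

  graphicahedron : Preorder _ _ _
  graphicahedron = record { Carrier = Elem G ; _≈_ = _∼_ ; _≲_ = _≤P_ ; isPreorder = ≤P-isPreorder }

  module ≤P-Reasoning = PreorderReasoning graphicahedron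

  actS-resp : (γ : Perm p) {x y : Elem G} → x ∼ y → actS γ x ∼ actS γ y
  actS-resp γ {bot}      {bot}      _   = tt
  actS-resp γ {face K α} {face L β} x∼y =
    face-∼ K L (α · γ) (β · γ) (∼⇒≐E K L α β x∼y) (sameCoset-·ʳ L α β γ (∼⇒sameCoset K L α β x∼y))

  actS-mono : (γ : Perm p) {x y : Elem G} → x ≤P y → actS γ x ≤P actS γ y
  actS-mono γ {bot}      {_}        _   = tt
  actS-mono γ {face K α} {face L β} x≤y =
    face-≤ K L (α · γ) (β · γ) (≤⇒⊆E K L α β x≤y) (sameCoset-·ʳ L α β γ (≤⇒sameCoset K L α β x≤y))

  face-resp-≈ : (K : EdgeSet G) (α β : Perm p) → α ≈ₚ β → face K α ∼ face K β
  face-resp-≈ K α β α≈β = face-∼ K K α β (λ _ _ → refl) (≈⇒sameCoset K α β α≈β)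

  actS-inverse : (γ : Perm p) (x : Elem G) → actS (γ ⁻¹) (actS γ x) ∼ x
  actS-inverse γ bot        = tt
  actS-inverse γ (face K α) = face-resp-≈ K (α · γ · γ ⁻¹) α (λ x → cong (α ⟨$⟩ʳ_) (inverseʳ γ))

  actS-isPosetAut : (γ : Perm p) → IsPosetAut G (actS γ)
  actS-isPosetAut γ = record
    { f-resp    = actS-resp γ
    ; inv       = actS (γ ⁻¹)
    ; inv-resp  = actS-resp (γ ⁻¹)
    ; inv-left  = actS-inverse γ
    ; inv-right = λ { bot → tt ; (face K α) → face-resp-≈ K (α · γ ⁻¹ · γ) α (λ x → cong (α ⟨$⟩ʳ_) (inverseˡ γ)) }
    ; mono      = actS-mono γ
    ; inv-mono  = actS-mono (γ ⁻¹) }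

  GraphAut⁻¹ : GraphAut G → GraphAut G
  GraphAut⁻¹ κ = record
    { perm     = perm κ ⁻¹
    ; preserve = λ i j → trans (sym (preserve κ (perm κ ⟨$⟩ˡ i) (perm κ ⟨$⟩ˡ j)))
                               (cong₂ (adj G) (inverseʳ (perm κ)) (inverseʳ (perm κ))) }

  actG-resp : (κ : GraphAut G) {x y : Elem G} → x ∼ y → actG κ x ∼ actG κ y
  actG-resp κ {bot}      {bot}      _   = tt
  actG-resp κ {face K α} {face L β} x∼y =
    face-∼ (imageE κ K) (imageE κ L) (conjugate (perm κ) α) (conjugate (perm κ) β)
      (λ i j → ∼⇒≐E K L α β x∼y _ _)
      (sameCoset-conj L κ α β (∼⇒sameCoset K L α β x∼y))

  actG-mono : (κ : GraphAut G) {x y : Elem G} → x ≤P y → actG κ x ≤P actG κ y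
  actG-mono κ {bot}      {_}        _   = tt
  actG-mono κ {face K α} {face L β} x≤y =
    face-≤ (imageE κ K) (imageE κ L) (conjugate (perm κ) α) (conjugate (perm κ) β)
      (λ i j → ≤⇒⊆E K L α β x≤y _ _)
      (sameCoset-conj L κ α β (≤⇒sameCoset K L α β x≤y))

  actG-inverse : (κ : GraphAut G) (x : Elem G) → actG (GraphAut⁻¹ κ) (actG κ x) ∼ x
  actG-inverse κ bot        = tt
  actG-inverse κ (face K α) =
    face-∼ (imageE (GraphAut⁻¹ κ) (imageE κ K)) K α′ α (λ i j → cong₂ (mem K) (inverseˡ (perm κ)) (inverseˡ (perm κ)))
      (≈⇒sameCoset K α′ α (λ x → trans (inverseˡ (perm κ)) (cong (α ⟨$⟩ʳ_) (inverseˡ (perm κ)))))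
    where α′ = conjugate (perm (GraphAut⁻¹ κ)) (conjugate (perm κ) α)

  actG-isPosetAut : (κ : GraphAut G) → IsPosetAut G (actG κ)
  actG-isPosetAut κ = record
    { f-resp    = actG-resp κ
    ; inv       = actG (GraphAut⁻¹ κ)
    ; inv-resp  = actG-resp (GraphAut⁻¹ κ)
    ; inv-left  = actG-inverse κ
    ; inv-right = λ { bot → tt ; (face K α) →
        face-∼ (imageE κ (imageE (GraphAut⁻¹ κ) K)) K (α′ α) α
          (λ i j → cong₂ (mem K) (inverseʳ (perm κ)) (inverseʳ (perm κ)))
          (≈⇒sameCoset K (α′ α) α (λ x → trans (inverseʳ (perm κ)) (cong (α ⟨$⟩ʳ_) (inverseʳ (perm κ))))) }
    ; mono      = actG-mono κ
    ; inv-mono  = actG-mono (GraphAut⁻¹ κ) }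
    where α′ = λ α → conjugate (perm κ) (conjugate (perm (GraphAut⁻¹ κ)) α)

  actG-actS : (γ : Perm p) (κ : GraphAut G) (x : Elem G) →
    actG κ (actS γ x) ∼ actS (perm κ · γ · (perm κ ⁻¹)) (actG κ x)
  actG-actS γ κ bot        = tt
  actG-actS γ κ (face K α) =
    face-resp-≈ (imageE κ K) (conjugate (perm κ) (α · γ)) (conjugate (perm κ) α · conjugate (perm κ) γ)
    (λ x → cong (λ y → perm κ ⟨$⟩ʳ (α ⟨$⟩ʳ y)) (sym (inverseˡ (perm κ))))

  inverseIsPosetAut : {f : Elem G → Elem G} (A : IsPosetAut G f) → IsPosetAut G (IsPosetAut.inv A)
  inverseIsPosetAut {f} A = record
    { f-resp = inv-resp ; inv = f ; inv-resp = f-resp ; inv-left = inv-right ; inv-right = inv-left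
    ; mono = inv-mono ; inv-mono = mono }
    where open IsPosetAut A

  ∘-isPosetAut : {f g : Elem G → Elem G} → IsPosetAut G f → IsPosetAut G g → IsPosetAut G (g ∘ f)
  ∘-isPosetAut {f} {g} A B = record
    { f-resp    = B.f-resp ∘ A.f-resp
    ; inv       = A.inv ∘ B.inv
    ; inv-resp  = A.inv-resp ∘ B.inv-resp
    ; inv-left  = λ x → ∼-trans (A.inv-resp (B.inv-left (f x))) (A.inv-left x)
    ; inv-right = λ x → ∼-trans (B.f-resp (A.inv-right (B.inv x))) (B.inv-right x)
    ; mono      = B.mono ∘ A.mono
    ; inv-mono  = A.inv-mono ∘ B.inv-mono }
    where
    module A = IsPosetAut A
    module B = IsPosetAut B

  module PosetAut {f : Elem G → Elem G} (A : IsPosetAut G f) where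
    open IsPosetAut A
    open ≤P-Reasoning

    reflects-≤ : (x y : Elem G) → f x ≤P f y → x ≤P y
    reflects-≤ x y fx≤fy = begin
      x           ≈⟨ inv-left x ⟨
      inv (f x)   ≲⟨ inv-mono fx≤fy ⟩
      inv (f y)   ≈⟨ inv-left y ⟩
      y           ∎

    reflects-∼ : (x y : Elem G) → f x ∼ f y → x ∼ y
    reflects-∼ x y fx∼fy = begin-equality
      x           ≈⟨ inv-left x ⟨
      inv (f x)   ≈⟨ inv-resp fx∼fy ⟩
      inv (f y)   ≈⟨ inv-left y ⟩
      y           ∎

    inv-below : (x y : Elem G) → y ≤P f x → inv y ≤P x
    inv-below x y y≤fx = begin
      inv y       ≲⟨ inv-mono y≤fx ⟩
      inv (f x)   ≈⟨ inv-left x ⟩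
      x           ∎

    inv-image : (x y : Elem G) → f x ∼ y → inv y ∼ x
    inv-image x y fx∼y = ∼-trans (inv-resp (∼-sym fx∼y)) (inv-left x)

    image-of-inv : (x y : Elem G) → inv y ∼ x → y ∼ f x
    image-of-inv x y invy∼x = ∼-trans (∼-sym (inv-right y)) (f-resp invy∼x)

    maps-bot : f bot ∼ bot
    maps-bot with f bot | ≤P-trans (mono {bot} {inv bot} tt) (∼⇒≤P (inv-right bot))
    ... | bot      | _  = tt
    ... | face K α | ()

    maps-face : (K : EdgeSet G) (α : Perm p) → Σ (EdgeSet G) λ L → Σ (Perm p) λ β → f (face K α) ∼ face L β
    maps-face K α with f (face K α) | reflects-∼ (face K α) bot
    ... | face L β | _ = L , β , ∼-refl {x = face L β}
    ... | bot      | reflect = ⊥-elim (reflect (∼-sym maps-bot))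

  atom : Perm p → Elem G
  atom α = face ∅E α

  edgeFace : Edge G → Perm p → Elem G
  edgeFace e α = face (singleE e) α

  atom-resp : (α β : Perm p) → α ≈ₚ β → atom α ∼ atom β
  atom-resp = face-resp-≈ ∅E

  atom-injective : (α β : Perm p) → atom α ∼ atom β → α ≈ₚ β
  atom-injective α β α∼β = sameCoset-∅ (∅E {G = G}) (λ _ _ → refl) α β (∼⇒sameCoset ∅E ∅E α β α∼β)

  atom-≤ : (K : EdgeSet G) (α : Perm p) → atom α ≤P face K α
  atom-≤ K α = face-≤ ∅E K α α (λ _ _ ()) (sameCoset-refl K α)

  empty-face : (K : EdgeSet G) (α : Perm p) → IsEmptyE K → face K α ∼ atom α
  empty-face K α K-empty = face-∼ K ∅E α α K-empty (sameCoset-refl (∅E {G = G}) α)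

  below-atom : (K : EdgeSet G) (α β : Perm p) → face K α ≤P atom β → face K α ∼ atom β
  below-atom K α β Kα≤β =
    face-∼ K ∅E α β (λ i j → ¬-not (λ ij∈K → case (≤⇒⊆E K ∅E α β Kα≤β i j ij∈K)))
      (≤⇒sameCoset K ∅E α β Kα≤β)
    where case : false ≡ true → ⊥
          case ()

  atom-∼ : (K : EdgeSet G) (α β : Perm p) → face K α ∼ atom β → IsEmptyE K
  atom-∼ K α β Kα∼β = ∼⇒≐E K ∅E α β Kα∼β

  edgeFace-≤ : (e : Edge G) (K : EdgeSet G) (α : Perm p) → e ∈E K → edgeFace e α ≤P face K α
  edgeFace-≤ e K α e∈K = face-≤ (singleE e) K α α (singleE-⊆ e K e∈K) (sameCoset-refl K α)

  edgeFace-≤⇒∈ : (e : Edge G) (K : EdgeSet G) (α β : Perm p) → edgeFace e α ≤P face K β → e ∈E K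
  edgeFace-≤⇒∈ e K α β e≤K = ≤⇒⊆E (singleE e) K α β e≤K _ _ (∈singleE e)

  edgeFace≁atom : (e : Edge G) (α β : Perm p) → ¬ edgeFace e α ∼ atom β
  edgeFace≁atom e α β eα∼β with trans (sym (∈singleE e)) (atom-∼ (singleE e) α β eα∼β (end₁ e) (end₂ e))
  ... | ()

  below-edgeFace : (K : EdgeSet G) (e : Edge G) (α β : Perm p) → face K α ≤P edgeFace e β →
    IsEmptyE K ⊎ face K α ∼ edgeFace e β
  below-edgeFace K e α β Kα≤eβ with emptyE? K
  ... | inj₂ K-empty     = inj₁ K-empty
  ... | inj₁ (e′ , e′∈K) = inj₂ (face-∼ K (singleE e) α β
          (⊆-singleE e K e′ (≤⇒⊆E K (singleE e) α β Kα≤eβ) e′∈K) (≤⇒sameCoset K (singleE e) α β Kα≤eβ))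

-- The vertex map and edge labelling of an automorphism

module Automorphism {G : Graph p} {f : Elem G → Elem G} (A : IsPosetAut G f) where
  open IsPosetAut A
  open PosetAut A
  private module Inv = PosetAut (inverseIsPosetAut A)
  open ≤P-Reasoning

  atomImage : (α : Perm p) → Σ (Perm p) λ β → f (atom α) ∼ atom β
  atomImage α with maps-face ∅E α
  ... | L , β , fα∼Lβ with Inv.maps-face ∅E β
  ...   | M , δ , invβ∼Mδ = β , ∼-trans fα∼Lβ (empty-face L β L-empty)
    where
    invβ≤α : inv (atom β) ≤P atom α
    invβ≤α = inv-below (atom α) (atom β) (begin
      atom β     ≲⟨ atom-≤ L β ⟩
      face L β   ≈⟨ fα∼Lβ ⟨
      f (atom α) ∎)
    invβ∼α : inv (atom β) ∼ atom α
    invβ∼α = ∼-trans invβ∼Mδ (below-atom M δ α (≤P-trans (∼⇒≤P (∼-sym invβ∼Mδ)) invβ≤α))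
    L-empty : IsEmptyE L
    L-empty = atom-∼ L β β (begin-equality
      face L β   ≈⟨ fα∼Lβ ⟨
      f (atom α) ≈⟨ image-of-inv (atom α) (atom β) invβ∼α ⟨
      atom β     ∎)

  φ : Perm p → Perm p
  φ α = proj₁ (atomImage α)

  φ-atom : (α : Perm p) → f (atom α) ∼ atom (φ α)
  φ-atom α = proj₂ (atomImage α)

  φ-injective : (α β : Perm p) → φ α ≈ₚ φ β → α ≈ₚ β
  φ-injective α β φα≈φβ = atom-injective {G = G} α β (reflects-∼ (atom α) (atom β) (begin-equality
    f (atom α)   ≈⟨ φ-atom α ⟩
    atom (φ α)   ≈⟨ atom-resp {G = G} (φ α) (φ β) φα≈φβ ⟩
    atom (φ β)   ≈⟨ φ-atom β ⟨
    f (atom β)   ∎))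

  φ-resp : (α β : Perm p) → α ≈ₚ β → φ α ≈ₚ φ β
  φ-resp α β α≈β = atom-injective {G = G} (φ α) (φ β) (begin-equality
    atom (φ α)   ≈⟨ φ-atom α ⟨
    f (atom α)   ≈⟨ f-resp (atom-resp {G = G} α β α≈β) ⟩
    f (atom β)   ≈⟨ φ-atom β ⟩
    atom (φ β)   ∎)

  image-based : (K : EdgeSet G) (α : Perm p) → Σ (EdgeSet G) λ N → f (face K α) ∼ face N (φ α)
  image-based K α with maps-face K α
  ... | L , β , fKα∼Lβ = L , ∼-trans fKα∼Lβ
    (face-∼ L L β (φ α) (λ _ _ → refl) (sameCoset-sym L (φ α) β (≤⇒sameCoset ∅E L (φ α) β (begin
      atom (φ α)   ≈⟨ φ-atom α ⟨
      f (atom α)   ≲⟨ mono (atom-≤ K α) ⟩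
      f (face K α) ≈⟨ fKα∼Lβ ⟩
      face L β     ∎))))

  edge-image-nonempty : (e : Edge G) (α : Perm p) (N : EdgeSet G) →
    f (edgeFace e α) ∼ face N (φ α) → ¬ IsEmptyE N
  edge-image-nonempty e α N feα∼N N-empty = edgeFace≁atom e α α (reflects-∼ (edgeFace e α) (atom α) (begin-equality
    f (edgeFace e α) ≈⟨ feα∼N ⟩
    face N (φ α)     ≈⟨ empty-face N (φ α) N-empty ⟩
    atom (φ α)       ≈⟨ φ-atom α ⟨
    f (atom α)       ∎))

  edge-image-member : (e : Edge G) (α : Perm p) (N : EdgeSet G) (c : Edge G) →
    f (edgeFace e α) ∼ face N (φ α) → c ∈E N → f (edgeFace e α) ∼ edgeFace c (φ α)
  edge-image-member e α N c feα∼N c∈N = ∼-sym (image-of-inv (edgeFace e α) (edgeFace c (φ α)) invc∼eα)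
    where
    M = proj₁ (Inv.maps-face (singleE c) (φ α))
    δ = proj₁ (proj₂ (Inv.maps-face (singleE c) (φ α)))
    invc∼Mδ : inv (edgeFace c (φ α)) ∼ face M δ
    invc∼Mδ = proj₂ (proj₂ (Inv.maps-face (singleE c) (φ α)))
    c≤feα : edgeFace c (φ α) ≤P f (edgeFace e α)
    c≤feα = begin
      edgeFace c (φ α)         ≲⟨ edgeFace-≤ c N (φ α) c∈N ⟩
      face N (φ α)             ≈⟨ feα∼N ⟨
      f (edgeFace e α)         ∎
    Mδ≤eα : face M δ ≤P edgeFace e α
    Mδ≤eα = begin
      face M δ                 ≈⟨ invc∼Mδ ⟨
      inv (edgeFace c (φ α))   ≲⟨ inv-below (edgeFace e α) (edgeFace c (φ α)) c≤feα ⟩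
      edgeFace e α             ∎
    M-nonempty : ¬ IsEmptyE M
    M-nonempty M-empty = edgeFace≁atom c (φ α) (φ δ) (begin-equality
      edgeFace c (φ α)   ≈⟨ image-of-inv (face M δ) (edgeFace c (φ α)) invc∼Mδ ⟩
      f (face M δ)       ≈⟨ f-resp (empty-face M δ M-empty) ⟩
      f (atom δ)         ≈⟨ φ-atom δ ⟩
      atom (φ δ)         ∎)
    Mδ∼eα : face M δ ∼ edgeFace e α
    Mδ∼eα with below-edgeFace M e δ α Mδ≤eα
    ... | inj₁ M-empty = ⊥-elim (M-nonempty M-empty)
    ... | inj₂ Mδ∼eα   = Mδ∼eα
    invc∼eα : inv (edgeFace c (φ α)) ∼ edgeFace e α
    invc∼eα = begin-equality
      inv (edgeFace c (φ α)) ≈⟨ invc∼Mδ ⟩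
      face M δ               ≈⟨ Mδ∼eα ⟩
      edgeFace e α           ∎

  edgeImage : (e : Edge G) (α : Perm p) → Σ (Edge G) λ e′ → f (edgeFace e α) ∼ edgeFace e′ (φ α)
  edgeImage e α = choose (emptyE? N)
    where
    N = proj₁ (image-based (singleE e) α)
    feα∼N : f (edgeFace e α) ∼ face N (φ α)
    feα∼N = proj₂ (image-based (singleE e) α)
    choose : Σ (Edge G) (_∈E N) ⊎ IsEmptyE N → Σ (Edge G) λ e′ → f (edgeFace e α) ∼ edgeFace e′ (φ α)
    choose (inj₁ (c , c∈N)) = c , edge-image-member e α N c feα∼N c∈N
    choose (inj₂ N-empty)   = ⊥-elim (edge-image-nonempty e α N feα∼N N-empty)

  image-⊆ : (K L K′ L′ : EdgeSet G) (α : Perm p) → K ⊆E L →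
    f (face K α) ∼ face K′ (φ α) → f (face L α) ∼ face L′ (φ α) → K′ ⊆E L′
  image-⊆ K L K′ L′ α K⊆L fK∼K′ fL∼L′ = ≤⇒⊆E K′ L′ (φ α) (φ α) (begin
    face K′ (φ α)   ≈⟨ fK∼K′ ⟨
    f (face K α)    ≲⟨ mono (face-≤ K L α α K⊆L (sameCoset-refl L α)) ⟩
    f (face L α)    ≈⟨ fL∼L′ ⟩
    face L′ (φ α)   ∎)

  image-∪ : (K L K′ L′ : EdgeSet G) (α : Perm p) →
    f (face K α) ∼ face K′ (φ α) → f (face L α) ∼ face L′ (φ α) →
    f (face (K ∪E L) α) ∼ face (K′ ∪E L′) (φ α)
  image-∪ K L K′ L′ α fK∼K′ fL∼L′ = ∼-sym (image-of-inv (face U α) (face W (φ α)) invW∼U)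
    where
    U = K ∪E L
    W = K′ ∪E L′
    N = proj₁ (image-based U α)
    fU∼N : f (face U α) ∼ face N (φ α)
    fU∼N = proj₂ (image-based U α)
    M = proj₁ (Inv.maps-face W (φ α))
    δ = proj₁ (proj₂ (Inv.maps-face W (φ α)))
    invW∼Mδ : inv (face W (φ α)) ∼ face M δ
    invW∼Mδ = proj₂ (proj₂ (Inv.maps-face W (φ α)))
    W≤fU : face W (φ α) ≤P f (face U α)
    W≤fU = begin
      face W (φ α)    ≲⟨ face-≤ W N (φ α) (φ α)
                           (∪-least K′ L′ N (image-⊆ K U K′ N α (⊆-∪ˡ K L) fK∼K′ fU∼N)
                                            (image-⊆ L U L′ N α (⊆-∪ʳ K L) fL∼L′ fU∼N))
                           (sameCoset-refl N (φ α)) ⟩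
      face N (φ α)    ≈⟨ fU∼N ⟨
      f (face U α)    ∎
    Mδ≤U : face M δ ≤P face U α
    Mδ≤U = begin
      face M δ           ≈⟨ invW∼Mδ ⟨
      inv (face W (φ α)) ≲⟨ inv-below (face U α) (face W (φ α)) W≤fU ⟩
      face U α           ∎
    part⊆M : (P P′ : EdgeSet G) → P′ ⊆E W → f (face P α) ∼ face P′ (φ α) → P ⊆E M
    part⊆M P P′ P′⊆W fP∼P′ = ≤⇒⊆E P M α δ (begin
      face P α            ≈⟨ inv-image (face P α) (face P′ (φ α)) fP∼P′ ⟨
      inv (face P′ (φ α)) ≲⟨ inv-mono (face-≤ P′ W (φ α) (φ α) P′⊆W (sameCoset-refl W (φ α))) ⟩
      inv (face W (φ α))  ≈⟨ invW∼Mδ ⟩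
      face M δ            ∎)
    M≐U : M ≐E U
    M≐U = ⊆E-antisym M U (≤⇒⊆E M U δ α Mδ≤U)
            (∪-least K L M (part⊆M K K′ (⊆-∪ˡ K′ L′) fK∼K′) (part⊆M L L′ (⊆-∪ʳ K′ L′) fL∼L′))
    invW∼U : inv (face W (φ α)) ∼ face U α
    invW∼U = begin-equality
      inv (face W (φ α))  ≈⟨ invW∼Mδ ⟩
      face M δ            ≈⟨ face-∼ M U δ α M≐U (≤⇒sameCoset M U δ α Mδ≤U) ⟩
      face U α            ∎

  LabelledAt : (Edge G → Edge G) → Perm p → Set
  LabelledAt ℓ α = ∀ e → f (edgeFace e α) ∼ edgeFace (ℓ e) (φ α)

  labelledAt-resp : (ℓ : Edge G → Edge G) (α β : Perm p) → α ≈ₚ β → LabelledAt ℓ α → LabelledAt ℓ β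
  labelledAt-resp ℓ α β α≈β labelled e = begin-equality
    f (edgeFace e β)       ≈⟨ f-resp (face-resp-≈ (singleE e) α β α≈β) ⟨
    f (edgeFace e α)       ≈⟨ labelled e ⟩
    edgeFace (ℓ e) (φ α)   ≈⟨ face-resp-≈ (singleE (ℓ e)) (φ α) (φ β) (φ-resp α β α≈β) ⟩
    edgeFace (ℓ e) (φ β)   ∎

  φ-τₑ : (ℓ : Edge G → Edge G) (α : Perm p) → LabelledAt ℓ α →
    (e : Edge G) → φ (τₑ e · α) ≈ₚ (τₑ (ℓ e) · φ α)
  φ-τₑ ℓ α labelled e = choose (sameCoset-singleE (ℓ e) (φ (τₑ e · α)) (φ α)
                                  (≤⇒sameCoset ∅E (singleE (ℓ e)) (φ (τₑ e · α)) (φ α) τα≤e))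
    where
    τα≤e : atom (φ (τₑ e · α)) ≤P edgeFace (ℓ e) (φ α)
    τα≤e = begin
      atom (φ (τₑ e · α))  ≈⟨ φ-atom (τₑ e · α) ⟨
      f (atom (τₑ e · α))  ≲⟨ mono (face-≤ ∅E (singleE e) (τₑ e · α) α (λ _ _ ())
                                (sameCoset-τ (singleE e) (end₁ e) (end₂ e) (∈singleE e) α)) ⟩
      f (edgeFace e α)     ≈⟨ labelled e ⟩
      edgeFace (ℓ e) (φ α) ∎
    choose : φ (τₑ e · α) ≈ₚ φ α ⊎ φ (τₑ e · α) ≈ₚ (τₑ (ℓ e) · φ α) → φ (τₑ e · α) ≈ₚ (τₑ (ℓ e) · φ α)
    choose (inj₁ φτα≈φα)  = ⊥-elim (τ·-moves (end₁ e) (end₂ e) α (end₁≢end₂ e)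
                                      (φ-injective (τₑ e · α) α φτα≈φα))
    choose (inj₂ φτα≈τφα) = φτα≈τφα

  -- The edge g based at τₑ e · α lies in the face ({e , g} , α), so its image lies in ({ℓ e , ℓ g} , φ α).
  module _ (ℓ : Edge G → Edge G) (α : Perm p) (labelled : LabelledAt ℓ α) (e g g″ : Edge G)
           (fgτα∼g″ : f (edgeFace g (τₑ e · α)) ∼ edgeFace g″ (φ (τₑ e · α))) where

    moved-label : g″ ∈E (singleE (ℓ e) ∪E singleE (ℓ g))
    moved-label = edgeFace-≤⇒∈ g″ W (φ (τₑ e · α)) (φ α) (begin
      edgeFace g″ (φ (τₑ e · α))   ≈⟨ fgτα∼g″ ⟨
      f (edgeFace g (τₑ e · α))    ≲⟨ mono (face-≤ (singleE g) U (τₑ e · α) α (⊆-∪ʳ (singleE e) (singleE g))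
                                       (sameCoset-τ U (end₁ e) (end₂ e) (⊆-∪ˡ (singleE e) (singleE g) (end₁ e) (end₂ e) (∈singleE e)) α)) ⟩
      f (face U α)                 ≈⟨ image-∪ (singleE e) (singleE g) (singleE (ℓ e)) (singleE (ℓ g)) α (labelled e) (labelled g) ⟩
      face W (φ α)                 ∎)
      where
      U = singleE e ∪E singleE g
      W = singleE (ℓ e) ∪E singleE (ℓ g)

    moved-label-collision : g″ ∈E singleE (ℓ e) → singleE (ℓ g) ≐E singleE (ℓ e)
    moved-label-collision g″∈ℓe = ∼⇒≐E (singleE (ℓ g)) (singleE (ℓ e)) (φ α) (φ α) (begin-equality
      edgeFace (ℓ g) (φ α)   ≈⟨ labelled g ⟨
      f (edgeFace g α)       ≈⟨ f-resp (face-∼ (singleE g) (singleE e) α α g≐e (sameCoset-refl (singleE e) α)) ⟩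
      f (edgeFace e α)       ≈⟨ labelled e ⟩
      edgeFace (ℓ e) (φ α)   ∎)
      where
      τφα≈φτα : SameCoset (singleE (ℓ e)) (φ (τₑ e · α)) (φ α)
      τφα≈φτα = sameCoset-trans (singleE (ℓ e)) (φ (τₑ e · α)) (τₑ (ℓ e) · φ α) (φ α)
                  (≈⇒sameCoset (singleE (ℓ e)) (φ (τₑ e · α)) (τₑ (ℓ e) · φ α) (φ-τₑ ℓ α labelled e))
                  (sameCoset-τ (singleE (ℓ e)) (end₁ (ℓ e)) (end₂ (ℓ e)) (∈singleE (ℓ e)) (φ α))
      g≐e : singleE g ≐E singleE e
      g≐e = ∼⇒≐E (singleE g) (singleE e) (τₑ e · α) α (reflects-∼ (edgeFace g (τₑ e · α)) (edgeFace e α) (begin-equality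
        f (edgeFace g (τₑ e · α))       ≈⟨ fgτα∼g″ ⟩
        edgeFace g″ (φ (τₑ e · α))      ≈⟨ face-∼ (singleE g″) (singleE (ℓ e)) (φ (τₑ e · α)) (φ α)
                                             (∈singleE⇒≐E (ℓ e) g″ g″∈ℓe) τφα≈φτα ⟩
        edgeFace (ℓ e) (φ α)            ≈⟨ labelled e ⟨
        f (edgeFace e α)                ∎))

  propagate : (ℓ : Edge G → Edge G) (α : Perm p) → LabelledAt ℓ α → (e : Edge G) → LabelledAt ℓ (τₑ e · α)
  propagate ℓ α labelled e g = ∼-trans fgτα∼g″ (face-∼ (singleE g″) (singleE (ℓ g)) (φ τα) (φ τα) g″≐ℓg
                                                   (sameCoset-refl (singleE (ℓ g)) (φ τα)))
    where
    τα = τₑ e · α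
    g″ = proj₁ (edgeImage g τα)
    fgτα∼g″ : f (edgeFace g τα) ∼ edgeFace g″ (φ τα)
    fgτα∼g″ = proj₂ (edgeImage g τα)
    choose : g″ ∈E singleE (ℓ e) ⊎ g″ ∈E singleE (ℓ g) → singleE g″ ≐E singleE (ℓ g)
    choose (inj₂ g″∈ℓg) = ∈singleE⇒≐E (ℓ g) g″ g″∈ℓg
    choose (inj₁ g″∈ℓe) i j = trans (∈singleE⇒≐E (ℓ e) g″ g″∈ℓe i j)
                                    (sym (moved-label-collision ℓ α labelled e g g″ fgτα∼g″ g″∈ℓe i j))
    g″≐ℓg : singleE g″ ≐E singleE (ℓ g)
    g″≐ℓg = choose (∨-true (mem (singleE (ℓ e)) (end₁ g″) (end₂ g″)) (mem (singleE (ℓ g)) (end₁ g″) (end₂ g″))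
                     (moved-label ℓ α labelled e g g″ fgτα∼g″))

  label : Edge G → Edge G
  label e = proj₁ (edgeImage e Permutation.id)


module AutomorphismOfConnected {G : Graph p} (connected : Connected G) {f : Elem G → Elem G} (A : IsPosetAut G f) where
  open Automorphism A

  labelled : (α : Perm p) → LabelledAt label α
  labelled α = InT-elim (fullE {G = G}) (LabelledAt label) (labelledAt-resp label)
    (λ e → proj₂ (edgeImage e Permutation.id))
    (λ i j σ i~j labelledσ → propagate label σ labelledσ (mkEdge i j i~j))
    α (InT-connected connected α)

  δ : Perm p
  δ = φ Permutation.id

  Φ : Perm p → Perm p
  Φ α = φ α · δ ⁻¹

  Φ-resp : (α β : Perm p) → α ≈ₚ β → Φ α ≈ₚ Φ β
  Φ-resp α β α≈β x = φ-resp α β α≈β (δ ⟨$⟩ˡ x)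

  Φ-injective : (α β : Perm p) → Φ α ≈ₚ Φ β → α ≈ₚ β
  Φ-injective α β Φα≈Φβ = φ-injective α β λ x →
    trans (cong (φ α ⟨$⟩ʳ_) (sym (inverseˡ δ)))
          (trans (Φα≈Φβ (δ ⟨$⟩ʳ x)) (cong (φ β ⟨$⟩ʳ_) (inverseˡ δ)))

  Φ-id : Φ Permutation.id ≈ₚ Permutation.id
  Φ-id x = inverseʳ δ

  Φ-τₑ : (e : Edge G) (α : Perm p) → Φ (τₑ e · α) ≈ₚ (τₑ (label e) · Φ α)
  Φ-τₑ e α x = φ-τₑ label α (labelled α) e (δ ⟨$⟩ˡ x)

  Φ-hom : (α β : Perm p) → Φ (α · β) ≈ₚ (Φ α · Φ β)
  Φ-hom α = InT-elim (fullE {G = G}) (λ α → ∀ β → Φ (α · β) ≈ₚ (Φ α · Φ β))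
    (λ α α′ α≈α′ hom β x → begin
      Φ (α′ · β) ⟨$⟩ʳ x       ≡⟨ Φ-resp (α · β) (α′ · β) (λ y → α≈α′ (β ⟨$⟩ʳ y)) x ⟨
      Φ (α · β) ⟨$⟩ʳ x        ≡⟨ hom β x ⟩
      Φ α ⟨$⟩ʳ (Φ β ⟨$⟩ʳ x)   ≡⟨ Φ-resp α α′ α≈α′ _ ⟩
      Φ α′ ⟨$⟩ʳ (Φ β ⟨$⟩ʳ x)  ∎)
    (λ β x → sym (Φ-id (Φ β ⟨$⟩ʳ x)))
    (λ i j σ i~j hom β x → Φ-τₑ-hom (mkEdge i j i~j) σ β (hom β) x)
    α (InT-connected connected α)
    where
    open ≡-Reasoning
    Φ-τₑ-hom : (e : Edge G) (σ β : Perm p) → Φ (σ · β) ≈ₚ (Φ σ · Φ β) →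
      Φ (τₑ e · σ · β) ≈ₚ (Φ (τₑ e · σ) · Φ β)
    Φ-τₑ-hom e σ β hom x = begin
      Φ (τₑ e · σ · β) ⟨$⟩ʳ x               ≡⟨ reassociate x ⟩
      Φ (τₑ e · (σ · β)) ⟨$⟩ʳ x             ≡⟨ Φ-τₑ e (σ · β) x ⟩
      τₑ (label e) ⟨$⟩ʳ (Φ (σ · β) ⟨$⟩ʳ x)   ≡⟨ cong (τₑ (label e) ⟨$⟩ʳ_) (hom x) ⟩
      τₑ (label e) ⟨$⟩ʳ (Φ σ ⟨$⟩ʳ (Φ β ⟨$⟩ʳ x)) ≡⟨ Φ-τₑ e σ (Φ β ⟨$⟩ʳ x) ⟨
      Φ (τₑ e · σ) ⟨$⟩ʳ (Φ β ⟨$⟩ʳ x)        ∎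
      where
      -- composition of permutations is associative only pointwise, not definitionally
      reassociate : Φ (τₑ e · σ · β) ≈ₚ Φ (τₑ e · (σ · β))
      reassociate = Φ-resp (τₑ e · σ · β) (τₑ e · (σ · β)) (λ _ → refl)

  Φ-⁻¹ : (π : Perm p) → Φ (π ⁻¹) ≈ₚ (Φ π ⁻¹)
  Φ-⁻¹ π x = begin
    Φ (π ⁻¹) ⟨$⟩ʳ x                          ≡⟨ cong (Φ (π ⁻¹) ⟨$⟩ʳ_) (inverseʳ (Φ π)) ⟨
    Φ (π ⁻¹) ⟨$⟩ʳ (Φ π ⟨$⟩ʳ (Φ π ⟨$⟩ˡ x))    ≡⟨ Φ-hom (π ⁻¹) π (Φ π ⟨$⟩ˡ x) ⟨
    Φ (π ⁻¹ · π) ⟨$⟩ʳ (Φ π ⟨$⟩ˡ x)           ≡⟨ Φ-resp (π ⁻¹ · π) Permutation.id (λ _ → inverseˡ π) _ ⟩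
    Φ Permutation.id ⟨$⟩ʳ (Φ π ⟨$⟩ˡ x)       ≡⟨ Φ-id _ ⟩
    Φ π ⟨$⟩ˡ x                               ∎
    where open ≡-Reasoning

  Φ-conjugate : (π σ : Perm p) → Φ (conjugate π σ) ≈ₚ conjugate (Φ π) (Φ σ)
  Φ-conjugate π σ x =
    trans (Φ-hom (π · σ) (π ⁻¹) x)
          (trans (Φ-hom π σ _) (cong (λ y → Φ π ⟨$⟩ʳ (Φ σ ⟨$⟩ʳ y)) (Φ-⁻¹ π x)))

  Φ-τ : (e₀ : Edge G) (a b : Fin p) → a ≢ b →
    Σ (Fin p) λ c → Σ (Fin p) λ d → c ≢ d × Φ (τ a b) ≈ₚ τ c d
  Φ-τ e₀ a b a≢b with moving-pair (end₁ e₀) (end₂ e₀) a b (end₁≢end₂ e₀) a≢b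
  ... | π , πi≡a , πj≡b =
    Φ π ⟨$⟩ʳ end₁ (label e₀) , Φ π ⟨$⟩ʳ end₂ (label e₀) ,
    end₁≢end₂ (label e₀) ∘ ⟨$⟩ʳ-injective (Φ π) ,
    λ x → begin
      Φ (τ a b) ⟨$⟩ʳ x                         ≡⟨ Φ-resp (τ a b) (conjugate π (τₑ e₀)) τab≈πτπ⁻¹ x ⟩
      Φ (conjugate π (τₑ e₀)) ⟨$⟩ʳ x           ≡⟨ Φ-conjugate π (τₑ e₀) x ⟩
      conjugate (Φ π) (Φ (τₑ e₀)) ⟨$⟩ʳ x       ≡⟨ cong (Φ π ⟨$⟩ʳ_) (Φ-τₑ-id (Φ π ⟨$⟩ˡ x)) ⟩
      conjugate (Φ π) (τₑ (label e₀)) ⟨$⟩ʳ x   ≡⟨ tr-conjugate (Φ π) (end₁ (label e₀)) (end₂ (label e₀)) x ⟩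
      tr (Φ π ⟨$⟩ʳ end₁ (label e₀)) (Φ π ⟨$⟩ʳ end₂ (label e₀)) x ∎
    where
    open ≡-Reasoning
    τab≈πτπ⁻¹ : τ a b ≈ₚ conjugate π (τₑ e₀)
    τab≈πτπ⁻¹ x = sym (trans (tr-conjugate π (end₁ e₀) (end₂ e₀) x) (cong₂ (λ u v → tr u v x) πi≡a πj≡b))
    Φ-τₑ-id : Φ (τₑ e₀) ≈ₚ τₑ (label e₀)
    Φ-τₑ-id y = trans (Φ-resp (τₑ e₀) (τₑ e₀ · Permutation.id) (λ _ → refl) y)
                      (trans (Φ-τₑ e₀ Permutation.id y) (cong (tr (end₁ (label e₀)) (end₂ (label e₀))) (Φ-id y)))

-- Automorphisms of S_p preserving transpositions

ThirdPoint : ℕ → Set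
ThirdPoint p = (z w : Fin p) → Σ (Fin p) λ c → c ≢ z × c ≢ w

commutes-with-τ⇒id : ThirdPoint p → (μ : Fin p → Fin p) → (∀ a b → μ ∘ tr a b ≗ tr a b ∘ μ) → μ ≗ id
commutes-with-τ⇒id third μ comm z with μ z ≟ z
... | yes μz≡z = μz≡z
... | no μz≢z with third z (μ z)
...   | c , c≢z , c≢μz = contradiction (begin
  μ z                    ≡⟨ cong μ (tr-fix (μ z) c (μz≢z ∘ sym) (c≢z ∘ sym)) ⟨
  μ (tr (μ z) c z)       ≡⟨ comm (μ z) c z ⟩
  tr (μ z) c (μ z)       ≡⟨ tr-left (μ z) c ⟩
  c                      ∎) (c≢μz ∘ sym)
  where open ≡-Reasoning

injective⇒permutation : (g : Fin p → Fin p) → (∀ {x y} → g x ≡ g y → x ≡ y) →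
  Σ (Perm p) λ π → (π ⟨$⟩ʳ_) ≗ g
injective⇒permutation {zero}  g g-inj = Permutation.id , λ ()
injective⇒permutation {suc n} g g-inj =
  Permutation.permutation g g⁻¹ (λ y → proj₂ (preimage y)) (λ x → g-inj (proj₂ (preimage (g x)))) , λ _ → refl
  where
  preimage : ∀ y → Σ (Fin (suc n)) λ x → g x ≡ y
  preimage y with any? (λ x → g x ≟ y)
  ... | yes found = found
  ... | no  none  = contradiction (injective⇒≤ squeeze-injective) (<-irrefl refl)
    where
    missed : ∀ x → y ≢ g x
    missed x y≡gx = none (x , sym y≡gx)
    squeeze : Fin (suc n) → Fin n
    squeeze x = punchOut (missed x)
    squeeze-injective : ∀ {x x′} → squeeze x ≡ squeeze x′ → x ≡ x′
    squeeze-injective {x} {x′} eq = g-inj (punchOut-injective (missed x) (missed x′) eq)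
  g⁻¹ : Fin (suc n) → Fin (suc n)
  g⁻¹ y = proj₁ (preimage y)

record SharedPoint (c₁ d₁ c₂ d₂ : Fin p) : Set where
  field
    w a b : Fin p
    a≢w    : a ≢ w
    b≢w    : b ≢ w
    a≢b    : a ≢ b
    first  : SamePair c₁ d₁ w a
    second : SamePair c₂ d₂ w b

meeting-pairs : (c₁ d₁ c₂ d₂ : Fin p) → c₁ ≢ d₁ → c₂ ≢ d₂ → ¬ SamePair c₁ d₁ c₂ d₂ →
  (c₁ ≢ c₂ → c₁ ≢ d₂ → d₁ ≢ c₂ → d₁ ≢ d₂ → ⊥) → SharedPoint c₁ d₁ c₂ d₂
meeting-pairs c₁ d₁ c₂ d₂ c₁≢d₁ c₂≢d₂ different meet
  with c₁ ≟ c₂ | c₁ ≟ d₂ | d₁ ≟ c₂ | d₁ ≟ d₂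
... | yes refl | _ | _ | _ = record
  { w = c₁ ; a = d₁ ; b = d₂ ; a≢w = c₁≢d₁ ∘ sym ; b≢w = c₂≢d₂ ∘ sym
  ; a≢b = λ { refl → different (inj₁ (refl , refl)) }
  ; first = inj₁ (refl , refl) ; second = inj₁ (refl , refl) }
... | no _ | yes refl | _ | _ = record
  { w = c₁ ; a = d₁ ; b = c₂ ; a≢w = c₁≢d₁ ∘ sym ; b≢w = c₂≢d₂
  ; a≢b = λ { refl → different (inj₂ (refl , refl)) }
  ; first = inj₁ (refl , refl) ; second = inj₂ (refl , refl) }
... | no _ | no _ | yes refl | _ = record
  { w = d₁ ; a = c₁ ; b = d₂ ; a≢w = c₁≢d₁ ; b≢w = c₂≢d₂ ∘ sym
  ; a≢b = λ { refl → different (inj₂ (refl , refl)) }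
  ; first = inj₂ (refl , refl) ; second = inj₁ (refl , refl) }
... | no _ | no _ | no _ | yes refl = record
  { w = d₁ ; a = c₁ ; b = c₂ ; a≢w = c₁≢d₁ ; b≢w = c₂≢d₂
  ; a≢b = λ { refl → different (inj₁ (refl , refl)) }
  ; first = inj₂ (refl , refl) ; second = inj₂ (refl , refl) }
... | no c₁≢c₂ | no c₁≢d₂ | no d₁≢c₂ | no d₁≢d₂ = ⊥-elim (meet c₁≢c₂ c₁≢d₂ d₁≢c₂ d₁≢d₂)

module TranspositionPreserving {p : ℕ} (third : ThirdPoint p) (Φ : Perm p → Perm p)
  (Φ-resp : ∀ α β → α ≈ₚ β → Φ α ≈ₚ Φ β)
  (Φ-injective : ∀ α β → Φ α ≈ₚ Φ β → α ≈ₚ β)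
  (Φ-hom : ∀ α β → Φ (α · β) ≈ₚ (Φ α · Φ β))
  (Φ-τ : ∀ a b → a ≢ b → Σ (Fin p) λ c → Σ (Fin p) λ d → c ≢ d × Φ (τ a b) ≈ₚ τ c d)
  where

  Φ-τ-sym : (a b : Fin p) → Φ (τ a b) ≈ₚ Φ (τ b a)
  Φ-τ-sym a b = Φ-resp (τ a b) (τ b a) (tr-sym a b)

  Φ-conjugate-τ : (w a b : Fin p) → a ≢ w → b ≢ w → a ≢ b →
    Φ (τ a b) ≈ₚ (Φ (τ w a) · Φ (τ w b) · Φ (τ w a))
  Φ-conjugate-τ w a b a≢w b≢w a≢b x =
    trans (Φ-resp (τ a b) (τ w a · τ w b · τ w a) (λ y → sym (tr-conjugate-tr w a b a≢w b≢w a≢b y)) x)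
          (trans (Φ-hom (τ w a · τ w b) (τ w a) x) (Φ-hom (τ w a) (τ w b) _))

  images-meet : (v a b : Fin p) → a ≢ v → b ≢ v → a ≢ b → (c₁ d₁ c₂ d₂ : Fin p) →
    Φ (τ v a) ≈ₚ τ c₁ d₁ → Φ (τ v b) ≈ₚ τ c₂ d₂ → c₁ ≢ c₂ → c₁ ≢ d₂ → d₁ ≢ c₂ → d₁ ≢ d₂ → ⊥
  images-meet v a b a≢v b≢v a≢b c₁ d₁ c₂ d₂ Φa Φb c₁≢c₂ c₁≢d₂ d₁≢c₂ d₁≢d₂ =
    τ-noncommuting v a b a≢v b≢v a≢b (Φ-injective (τ v a · τ v b) (τ v b · τ v a) λ x → begin
      Φ (τ v a · τ v b) ⟨$⟩ʳ x   ≡⟨ Φ-hom (τ v a) (τ v b) x ⟩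
      Φ (τ v a) ⟨$⟩ʳ (Φ (τ v b) ⟨$⟩ʳ x) ≡⟨ trans (Φa _) (cong (tr c₁ d₁) (Φb x)) ⟩
      tr c₁ d₁ (tr c₂ d₂ x)       ≡⟨ tr-disjoint-comm c₁ d₁ c₂ d₂ (c₁≢c₂ ∘ sym) (d₁≢c₂ ∘ sym) (c₁≢d₂ ∘ sym) (d₁≢d₂ ∘ sym) x ⟩
      tr c₂ d₂ (tr c₁ d₁ x)       ≡⟨ trans (Φb _) (cong (tr c₂ d₂) (Φa x)) ⟨
      Φ (τ v b) ⟨$⟩ʳ (Φ (τ v a) ⟨$⟩ʳ x) ≡⟨ Φ-hom (τ v b) (τ v a) x ⟨
      Φ (τ v b · τ v a) ⟨$⟩ʳ x   ∎)
    where open ≡-Reasoning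

  images-differ : (v a b : Fin p) → a ≢ b → (c₁ d₁ c₂ d₂ : Fin p) →
    Φ (τ v a) ≈ₚ τ c₁ d₁ → Φ (τ v b) ≈ₚ τ c₂ d₂ → ¬ SamePair c₁ d₁ c₂ d₂
  images-differ v a b a≢b c₁ d₁ c₂ d₂ Φa Φb same = a≢b
    (trans (sym (tr-left v a)) (trans (τva≈τvb v) (tr-left v b)))
    where
    τva≈τvb : τ v a ≈ₚ τ v b
    τva≈τvb = Φ-injective (τ v a) (τ v b) λ x → trans (Φa x) (trans (tr-cong same x) (sym (Φb x)))

  record Centre (v : Fin p) : Set where
    field
      a b w a′ b′ : Fin p
      a≢v  : a ≢ v
      b≢v  : b ≢ v
      a≢b  : a ≢ b
      a′≢w : a′ ≢ w
      b′≢w : b′ ≢ w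
      a′≢b′ : a′ ≢ b′
      Φa   : Φ (τ v a) ≈ₚ τ w a′
      Φb   : Φ (τ v b) ≈ₚ τ w b′

  centre : (v : Fin p) → Centre v
  centre v with third v v
  ... | a , a≢v , _ with third v a
  ...   | b , b≢v , b≢a with Φ-τ v a (a≢v ∘ sym) | Φ-τ v b (b≢v ∘ sym)
  ...     | c₁ , d₁ , c₁≢d₁ , Φa | c₂ , d₂ , c₂≢d₂ , Φb = record
    { a = a ; b = b ; w = w ; a′ = a′ ; b′ = b′
    ; a≢v = a≢v ; b≢v = b≢v ; a≢b = b≢a ∘ sym ; a′≢w = a≢w ; b′≢w = b≢w ; a′≢b′ = SharedPoint.a≢b s
    ; Φa = λ x → trans (Φa x) (tr-cong first x)
    ; Φb = λ x → trans (Φb x) (tr-cong second x) }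
    where
    s : SharedPoint c₁ d₁ c₂ d₂
    s = meeting-pairs c₁ d₁ c₂ d₂ c₁≢d₁ c₂≢d₂
          (images-differ v a b (b≢a ∘ sym) c₁ d₁ c₂ d₂ Φa Φb)
          (images-meet v a b a≢v b≢v (b≢a ∘ sym) c₁ d₁ c₂ d₂ Φa Φb)
    open SharedPoint s renaming (a to a′; b to b′; a≢w to a≢w; b≢w to b≢w)

  κ : Fin p → Fin p
  κ v = Centre.w (centre v)

  member : (z c d : Fin p) → (z ≢ c → z ≢ d → ⊥) → z ≡ c ⊎ z ≡ d
  member z c d neither with z ≟ c | z ≟ d
  ... | yes z≡c | _       = inj₁ z≡c
  ... | no _    | yes z≡d = inj₂ z≡d
  ... | no z≢c  | no z≢d  = ⊥-elim (neither z≢c z≢d)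

  module _ {v : Fin p} (C : Centre v) where
    open Centre C

    -- If Φ (τ v x) did not move w, meeting both τ w a′ and τ w b′ would force it to be τ a′ b′ = Φ (τ a b).
    star-around : (x : Fin p) → x ≢ v → Σ (Fin p) λ y → y ≢ w × Φ (τ v x) ≈ₚ τ w y
    star-around x x≢v with x ≟ a | x ≟ b
    ... | yes refl | _        = a′ , a′≢w , Φa
    ... | no _     | yes refl = b′ , b′≢w , Φb
    ... | no x≢a   | no x≢b with Φ-τ v x (x≢v ∘ sym)
    ...   | c , d , c≢d , Φx with w ≟ c | w ≟ d
    ...     | yes refl | _        = d , c≢d ∘ sym , Φx
    ...     | no _     | yes refl = c , c≢d , λ z → trans (Φx z) (tr-sym c d z)
    ...     | no w≢c   | no w≢d   = ⊥-elim (v∉ab (tr-injective v x a b (x≢v ∘ sym) τvx≈τab))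
      where
      endpoint : (z y : Fin p) → y ≢ v → y ≢ x → Φ (τ v y) ≈ₚ τ w z → z ≡ c ⊎ z ≡ d
      endpoint z y y≢v y≢x Φy = member z c d (images-meet v y x y≢v x≢v y≢x w z c d Φy Φx w≢c w≢d)
      cd≡a′b′ : SamePair c d a′ b′
      cd≡a′b′ = samePair-sym (samePair-of-members a′≢b′
                  (endpoint a′ a a≢v (x≢a ∘ sym) Φa) (endpoint b′ b b≢v (x≢b ∘ sym) Φb))
      τvx≈τab : τ v x ≈ₚ τ a b
      τvx≈τab = Φ-injective (τ v x) (τ a b) λ z → begin
        Φ (τ v x) ⟨$⟩ʳ z                 ≡⟨ trans (Φx z) (tr-cong cd≡a′b′ z) ⟩
        tr a′ b′ z                       ≡⟨ tr-conjugate-tr w a′ b′ a′≢w b′≢w a′≢b′ z ⟨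
        tr w a′ (tr w b′ (tr w a′ z))    ≡⟨ sym (trans (Φa _) (cong (tr w a′) (trans (Φb _) (cong (tr w b′) (Φa z))))) ⟩
        (Φ (τ v a) · Φ (τ v b) · Φ (τ v a)) ⟨$⟩ʳ z ≡⟨ Φ-conjugate-τ v a b a≢v b≢v a≢b z ⟨
        Φ (τ a b) ⟨$⟩ʳ z                 ∎
        where open ≡-Reasoning
      v∉ab : ¬ SamePair v x a b
      v∉ab (inj₁ (v≡a , _)) = a≢v (sym v≡a)
      v∉ab (inj₂ (v≡b , _)) = b≢v (sym v≡b)

  star : (v x : Fin p) → x ≢ v → Σ (Fin p) λ y → y ≢ κ v × Φ (τ v x) ≈ₚ τ (κ v) y
  star v = star-around (centre v)

  common-centre-impossible : {v u x w y₁ y₂ y₃ : Fin p} → v ≢ u → x ≢ v → x ≢ u →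
    y₁ ≢ w → y₂ ≢ w → y₃ ≢ w →
    Φ (τ v x) ≈ₚ τ w y₁ → Φ (τ u x) ≈ₚ τ w y₂ → Φ (τ v u) ≈ₚ τ w y₃ → ⊥
  common-centre-impossible {v} {u} {x} {w} {y₁} {y₂} {y₃} v≢u x≢v x≢u y₁≢w y₂≢w y₃≢w Φ₁ Φ₂ Φ₃ =
    [ (λ { (w≡y₁ , _) → y₁≢w (sym w≡y₁) }) , (λ { (w≡y₂ , _) → y₂≢w (sym w≡y₂) }) ]′
      (tr-injective w y₃ y₁ y₂ (y₃≢w ∘ sym) λ z → trans (sym (Φ₃ z)) (Φvu z))
    where
    y₁≢y₂ : y₁ ≢ y₂
    y₁≢y₂ refl = x≢v (begin
      x                ≡⟨ tr-left v x ⟨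
      tr v x v         ≡⟨ Φ-injective (τ v x) (τ u x) (λ z → trans (Φ₁ z) (sym (Φ₂ z))) v ⟩
      tr u x v         ≡⟨ tr-fix u x v≢u (x≢v ∘ sym) ⟩
      v                ∎)
      where open ≡-Reasoning
    Φxv : Φ (τ x v) ≈ₚ τ w y₁
    Φxv z = trans (Φ-τ-sym x v z) (Φ₁ z)
    Φxu : Φ (τ x u) ≈ₚ τ w y₂
    Φxu z = trans (Φ-τ-sym x u z) (Φ₂ z)
    Φvu : Φ (τ v u) ≈ₚ τ y₁ y₂
    Φvu z = begin
      Φ (τ v u) ⟨$⟩ʳ z                            ≡⟨ Φ-conjugate-τ x v u (x≢v ∘ sym) (x≢u ∘ sym) v≢u z ⟩
      (Φ (τ x v) · Φ (τ x u) · Φ (τ x v)) ⟨$⟩ʳ z  ≡⟨ trans (Φxv _) (cong (tr w y₁) (trans (Φxu _) (cong (tr w y₂) (Φxv z)))) ⟩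
      tr w y₁ (tr w y₂ (tr w y₁ z))               ≡⟨ tr-conjugate-tr w y₁ y₂ y₁≢w y₂≢w y₁≢y₂ z ⟩
      tr y₁ y₂ z                                  ∎
      where open ≡-Reasoning

  κ-injective : {v u : Fin p} → κ v ≡ κ u → v ≡ u
  κ-injective {v} {u} κv≡κu with v ≟ u
  ... | yes v≡u = v≡u
  ... | no v≢u  = ⊥-elim (common-centre-impossible v≢u x≢v x≢u
                    (proj₁ (proj₂ (star v x x≢v))) y₂≢κv (proj₁ (proj₂ (star v u (v≢u ∘ sym))))
                    (proj₂ (proj₂ (star v x x≢v))) Φux (proj₂ (proj₂ (star v u (v≢u ∘ sym)))))
    where
    x = proj₁ (third v u)
    x≢v = proj₁ (proj₂ (third v u))
    x≢u = proj₂ (proj₂ (third v u))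
    y₂ = proj₁ (star u x x≢u)
    y₂≢κv : y₂ ≢ κ v
    y₂≢κv y₂≡κv = proj₁ (proj₂ (star u x x≢u)) (trans y₂≡κv κv≡κu)
    Φux : Φ (τ u x) ≈ₚ τ (κ v) y₂
    Φux z = trans (proj₂ (proj₂ (star u x x≢u)) z) (cong (λ t → tr t y₂ z) (sym κv≡κu))

  Φ-τ-κ : (a b : Fin p) → a ≢ b → Φ (τ a b) ≈ₚ τ (κ a) (κ b)
  Φ-τ-κ a b a≢b = towards (tr-injective (κ a) y (κ b) y′ (y≢κa ∘ sym)
                            (λ z → trans (sym (Φab z)) (trans (Φ-τ-sym a b z) (Φba z))))
    where
    y = proj₁ (star a b (a≢b ∘ sym))
    y≢κa = proj₁ (proj₂ (star a b (a≢b ∘ sym)))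
    Φab : Φ (τ a b) ≈ₚ τ (κ a) y
    Φab = proj₂ (proj₂ (star a b (a≢b ∘ sym)))
    y′ = proj₁ (star b a a≢b)
    Φba : Φ (τ b a) ≈ₚ τ (κ b) y′
    Φba = proj₂ (proj₂ (star b a a≢b))
    towards : SamePair (κ a) y (κ b) y′ → Φ (τ a b) ≈ₚ τ (κ a) (κ b)
    towards (inj₁ (κa≡κb , _)) = contradiction (κ-injective κa≡κb) a≢b
    towards (inj₂ (_ , y≡κb))  = λ z → trans (Φab z) (cong (λ t → tr (κ a) t z) y≡κb)

-- Decomposition of an automorphism

module _ {G : Graph p} where

  fixing-atoms-and-edges⇒identity : {h : Elem G → Elem G} → IsPosetAut G h →
    ((α : Perm p) → h (atom α) ∼ atom α) → ((e : Edge G) (α : Perm p) → h (edgeFace e α) ∼ edgeFace e α) →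
    (x : Elem G) → h x ∼ x
  fixing-atoms-and-edges⇒identity {h} H fix-atom fix-edge bot = PosetAut.maps-bot H
  fixing-atoms-and-edges⇒identity {h} H fix-atom fix-edge (face K α) with PosetAut.maps-face H K α
  ... | L , β , hK∼Lβ = ∼-trans hK∼Lα (face-∼ L K α α (⊆E-antisym L K L⊆K K⊆L) (sameCoset-refl K α))
    where
    open IsPosetAut H
    open ≤P-Reasoning
    hK∼Lα : h (face K α) ∼ face L α
    hK∼Lα = ∼-trans hK∼Lβ (face-∼ L L β α (λ _ _ → refl) (sameCoset-sym L α β (≤⇒sameCoset ∅E L α β (begin
      atom α           ≈⟨ fix-atom α ⟨
      h (atom α)       ≲⟨ mono (atom-≤ K α) ⟩
      h (face K α)     ≈⟨ hK∼Lβ ⟩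
      face L β         ∎))))
    K⊆L : K ⊆E L
    K⊆L i j ij∈K = edgeFace-≤⇒∈ e L α α (begin
      edgeFace e α     ≈⟨ fix-edge e α ⟨
      h (edgeFace e α) ≲⟨ mono (edgeFace-≤ e K α ij∈K) ⟩
      h (face K α)     ≈⟨ hK∼Lα ⟩
      face L α         ∎)
      where e = edgeIn K i j ij∈K
    L⊆K : L ⊆E K
    L⊆K i j ij∈L = edgeFace-≤⇒∈ e K α α (PosetAut.reflects-≤ H (edgeFace e α) (face K α) (begin
      h (edgeFace e α) ≈⟨ fix-edge e α ⟩
      edgeFace e α     ≲⟨ edgeFace-≤ e L α ij∈L ⟩
      face L α         ≈⟨ hK∼Lα ⟨
      h (face K α)     ∎))
      where e = edgeIn L i j ij∈L

  agreeing-on-atoms-and-edges : {f g : Elem G → Elem G} → IsPosetAut G f → IsPosetAut G g →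
    ((α : Perm p) → f (atom α) ∼ g (atom α)) → ((e : Edge G) (α : Perm p) → f (edgeFace e α) ∼ g (edgeFace e α)) →
    (x : Elem G) → f x ∼ g x
  agreeing-on-atoms-and-edges {f} {g} F Γ on-atoms on-edges x = begin-equality
    f x                   ≈⟨ inv-right (f x) ⟨
    g (inv (f x))         ≈⟨ f-resp (fixing-atoms-and-edges⇒identity (∘-isPosetAut F (inverseIsPosetAut Γ))
                                       (λ α → inv-image (atom α) (f (atom α)) (∼-sym (on-atoms α)))
                                       (λ e α → inv-image (edgeFace e α) (f (edgeFace e α)) (∼-sym (on-edges e α))) x) ⟩
    g x                   ∎
    where
    open IsPosetAut Γ
    open PosetAut Γ
    open ≤P-Reasoning

  decomposition-unique : ThirdPoint p → (γ γ′ : Perm p) (κ κ′ : GraphAut G) →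
    ((x : Elem G) → actG κ (actS γ x) ∼ actG κ′ (actS γ′ x)) → (γ ≈ₚ γ′) × (perm κ ≈ₚ perm κ′)
  decomposition-unique third γ γ′ κ κ′ same =
    (λ z → trans (sym (μ-id (γ ⟨$⟩ʳ z))) (trans (μγ z) (cong (γ′ ⟨$⟩ʳ_) (μ-id z)))) ,
    (λ z → trans (sym (inverseʳ (perm κ′))) (cong (perm κ′ ⟨$⟩ʳ_) (μ-id z)))
    where
    μ : Fin p → Fin p
    μ z = perm κ′ ⟨$⟩ˡ (perm κ ⟨$⟩ʳ z)
    on-atoms : (α : Perm p) → conjugate (perm κ) (α · γ) ≈ₚ conjugate (perm κ′) (α · γ′)
    on-atoms α = sameCoset-∅ (imageE κ′ ∅E) (λ _ _ → refl) (conjugate (perm κ) (α · γ)) (conjugate (perm κ′) (α · γ′))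
      (∼⇒sameCoset (imageE κ ∅E) (imageE κ′ ∅E) (conjugate (perm κ) (α · γ)) (conjugate (perm κ′) (α · γ′))
        (same (atom α)))
    μαγ : (α : Perm p) (z : Fin p) → μ (α ⟨$⟩ʳ (γ ⟨$⟩ʳ z)) ≡ α ⟨$⟩ʳ (γ′ ⟨$⟩ʳ μ z)
    μαγ α z = begin
      perm κ′ ⟨$⟩ˡ (perm κ ⟨$⟩ʳ (α ⟨$⟩ʳ (γ ⟨$⟩ʳ z)))
        ≡⟨ cong (λ y → perm κ′ ⟨$⟩ˡ (perm κ ⟨$⟩ʳ (α ⟨$⟩ʳ (γ ⟨$⟩ʳ y)))) (inverseˡ (perm κ)) ⟨
      perm κ′ ⟨$⟩ˡ (conjugate (perm κ) (α · γ) ⟨$⟩ʳ (perm κ ⟨$⟩ʳ z))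
        ≡⟨ cong (perm κ′ ⟨$⟩ˡ_) (on-atoms α (perm κ ⟨$⟩ʳ z)) ⟩
      perm κ′ ⟨$⟩ˡ (perm κ′ ⟨$⟩ʳ (α ⟨$⟩ʳ (γ′ ⟨$⟩ʳ μ z)))
        ≡⟨ inverseˡ (perm κ′) ⟩
      α ⟨$⟩ʳ (γ′ ⟨$⟩ʳ μ z) ∎
      where open ≡-Reasoning
    μγ : (z : Fin p) → μ (γ ⟨$⟩ʳ z) ≡ γ′ ⟨$⟩ʳ μ z
    μγ = μαγ Permutation.id
    μ-id : μ ≗ id
    μ-id = commutes-with-τ⇒id third μ λ a b w → begin
      μ (tr a b w)                            ≡⟨ cong (μ ∘ tr a b) (inverseʳ γ) ⟨
      μ (tr a b (γ ⟨$⟩ʳ (γ ⟨$⟩ˡ w)))          ≡⟨ μαγ (τ a b) (γ ⟨$⟩ˡ w) ⟩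
      tr a b (γ′ ⟨$⟩ʳ μ (γ ⟨$⟩ˡ w))           ≡⟨ cong (tr a b) (μγ (γ ⟨$⟩ˡ w)) ⟨
      tr a b (μ (γ ⟨$⟩ʳ (γ ⟨$⟩ˡ w)))          ≡⟨ cong (tr a b ∘ μ) (inverseʳ γ) ⟩
      tr a b (μ w)                            ∎
      where open ≡-Reasoning

module Decomposition {G : Graph p} (connected : Connected G) (third : ThirdPoint p) (e₀ : Edge G)
  {f : Elem G → Elem G} (A : IsPosetAut G f) where
  open IsPosetAut A
  open Automorphism A
  open AutomorphismOfConnected connected A
  open TranspositionPreserving third Φ Φ-resp Φ-injective Φ-hom (Φ-τ e₀)

  κ̂ : Perm p
  κ̂ = proj₁ (injective⇒permutation κ κ-injective)

  κ̂-apply : (κ̂ ⟨$⟩ʳ_) ≗ κ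
  κ̂-apply = proj₂ (injective⇒permutation κ κ-injective)

  Φ-τ-κ̂ : (a b : Fin p) → a ≢ b → Φ (τ a b) ≈ₚ τ (κ̂ ⟨$⟩ʳ a) (κ̂ ⟨$⟩ʳ b)
  Φ-τ-κ̂ a b a≢b x = trans (Φ-τ-κ a b a≢b x) (sym (cong₂ (λ u v → tr u v x) (κ̂-apply a) (κ̂-apply b)))

  Φ-conjugation : (α : Perm p) → Φ α ≈ₚ conjugate κ̂ α
  Φ-conjugation α = InT-elim (fullE {G = G}) (λ α → Φ α ≈ₚ conjugate κ̂ α)
    (λ α β α≈β Φα≈ x → trans (sym (Φ-resp α β α≈β x)) (trans (Φα≈ x) (cong (κ̂ ⟨$⟩ʳ_) (α≈β _))))
    (λ x → trans (Φ-id x) (sym (inverseʳ κ̂)))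
    (λ i j σ i~j Φσ≈ x → begin
      Φ (τ i j · σ) ⟨$⟩ʳ x                        ≡⟨ Φ-hom (τ i j) σ x ⟩
      Φ (τ i j) ⟨$⟩ʳ (Φ σ ⟨$⟩ʳ x)                ≡⟨ Φ-τ-κ̂ i j (adjacent⇒≢ {G = G} i~j) (Φ σ ⟨$⟩ʳ x) ⟩
      tr (κ̂ ⟨$⟩ʳ i) (κ̂ ⟨$⟩ʳ j) (Φ σ ⟨$⟩ʳ x)      ≡⟨ cong (tr (κ̂ ⟨$⟩ʳ i) (κ̂ ⟨$⟩ʳ j)) (Φσ≈ x) ⟩
      tr (κ̂ ⟨$⟩ʳ i) (κ̂ ⟨$⟩ʳ j) (conjugate κ̂ σ ⟨$⟩ʳ x) ≡⟨ conj-τ κ̂ i j σ x ⟨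
      conjugate κ̂ (τ i j · σ) ⟨$⟩ʳ x             ∎)
    α (InT-connected connected α)
    where open ≡-Reasoning

  label-image : (e : Edge G) → SamePair (end₁ (label e)) (end₂ (label e)) (κ̂ ⟨$⟩ʳ end₁ e) (κ̂ ⟨$⟩ʳ end₂ e)
  label-image e = tr-injective (end₁ (label e)) (end₂ (label e)) (κ̂ ⟨$⟩ʳ end₁ e) (κ̂ ⟨$⟩ʳ end₂ e) (end₁≢end₂ (label e)) λ x → begin
    tr (end₁ (label e)) (end₂ (label e)) x     ≡⟨ cong (tr (end₁ (label e)) (end₂ (label e))) (Φ-id x) ⟨
    (τₑ (label e) · Φ Permutation.id) ⟨$⟩ʳ x   ≡⟨ Φ-τₑ e Permutation.id x ⟨
    Φ (τₑ e · Permutation.id) ⟨$⟩ʳ x           ≡⟨ Φ-resp (τₑ e · Permutation.id) (τₑ e) (λ _ → refl) x ⟩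
    Φ (τₑ e) ⟨$⟩ʳ x                            ≡⟨ Φ-τ-κ̂ (end₁ e) (end₂ e) (end₁≢end₂ e) x ⟩
    tr (κ̂ ⟨$⟩ʳ end₁ e) (κ̂ ⟨$⟩ʳ end₂ e) x       ∎
    where open ≡-Reasoning

  label-onto : (e′ : Edge G) → Σ (Edge G) λ e → SameEdge e′ (label e)
  label-onto e′ with Automorphism.edgeImage (inverseIsPosetAut A) e′ Permutation.id
  ... | e , inv-e′∼e = e , singleE-injective e′ (label e) (∼⇒≐E (singleE e′) (singleE (label e)) Permutation.id (φ ψ) (begin-equality
    edgeFace e′ Permutation.id          ≈⟨ PosetAut.image-of-inv A (edgeFace e ψ) (edgeFace e′ Permutation.id) inv-e′∼e ⟩
    f (edgeFace e ψ)                    ≈⟨ labelled ψ e ⟩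
    edgeFace (label e) (φ ψ)            ∎))
    where
    open ≤P-Reasoning
    ψ = Automorphism.φ (inverseIsPosetAut A) Permutation.id

  κ̂-adjacent : (e : Edge G) → adj G (κ̂ ⟨$⟩ʳ end₁ e) (κ̂ ⟨$⟩ʳ end₂ e) ≡ true
  κ̂-adjacent e = adjacent-samePair G (label-image e) (adjacent (label e))

  κ̂-reflects-adjacent : (i j : Fin p) → adj G (κ̂ ⟨$⟩ʳ i) (κ̂ ⟨$⟩ʳ j) ≡ true → adj G i j ≡ true
  κ̂-reflects-adjacent i j κi~κj = adjacent-samePair G (samePair-sym ij~e) (adjacent e)
    where
    e = proj₁ (label-onto (mkEdge (κ̂ ⟨$⟩ʳ i) (κ̂ ⟨$⟩ʳ j) κi~κj))
    κij~ℓe : SamePair (κ̂ ⟨$⟩ʳ i) (κ̂ ⟨$⟩ʳ j) (end₁ (label e)) (end₂ (label e))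
    κij~ℓe = proj₂ (label-onto (mkEdge (κ̂ ⟨$⟩ʳ i) (κ̂ ⟨$⟩ʳ j) κi~κj))
    ij~e : SamePair i j (end₁ e) (end₂ e)
    ij~e = samePair-injective {a = i} {j} {end₁ e} {end₂ e} (κ̂ ⟨$⟩ʳ_) (⟨$⟩ʳ-injective κ̂)
             (samePair-trans κij~ℓe (label-image e))

  κ̂-preserves-adjacency : (i j : Fin p) → adj G (κ̂ ⟨$⟩ʳ i) (κ̂ ⟨$⟩ʳ j) ≡ adj G i j
  κ̂-preserves-adjacency i j = by-value (adj G i j) refl
    where
    by-value : (b : Bool) → adj G i j ≡ b → adj G (κ̂ ⟨$⟩ʳ i) (κ̂ ⟨$⟩ʳ j) ≡ b
    by-value true  i~j = κ̂-adjacent (mkEdge i j i~j)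
    by-value false i≁j = ¬-not λ κi~κj → case (trans (sym (κ̂-reflects-adjacent i j κi~κj)) i≁j)
      where case : true ≡ false → ⊥
            case ()

  κ̂-aut : GraphAut G
  κ̂-aut = record { perm = κ̂ ; preserve = κ̂-preserves-adjacency }

  -- φ α = Φ α · δ = κ̂ α κ̂⁻¹ δ = κ̂ (α γ) κ̂⁻¹
  γ : Perm p
  γ = κ̂ ⁻¹ · δ · κ̂

  φ-decomposed : (α : Perm p) → φ α ≈ₚ conjugate κ̂ (α · γ)
  φ-decomposed α x = begin
    φ α ⟨$⟩ʳ x                                 ≡⟨ cong (φ α ⟨$⟩ʳ_) (inverseˡ δ) ⟨
    Φ α ⟨$⟩ʳ (δ ⟨$⟩ʳ x)                        ≡⟨ Φ-conjugation α (δ ⟨$⟩ʳ x) ⟩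
    κ̂ ⟨$⟩ʳ (α ⟨$⟩ʳ (κ̂ ⟨$⟩ˡ (δ ⟨$⟩ʳ x)))          ≡⟨ cong (λ y → κ̂ ⟨$⟩ʳ (α ⟨$⟩ʳ (κ̂ ⟨$⟩ˡ (δ ⟨$⟩ʳ y)))) (inverseʳ κ̂) ⟨
    conjugate κ̂ (α · γ) ⟨$⟩ʳ x                 ∎
    where open ≡-Reasoning

  on-atoms : (α : Perm p) → f (atom α) ∼ actG κ̂-aut (actS γ (atom α))
  on-atoms α = begin-equality
    f (atom α)                      ≈⟨ φ-atom α ⟩
    atom (φ α)                      ≈⟨ face-∼ ∅E (imageE κ̂-aut ∅E) (φ α) (conjugate κ̂ (α · γ)) (λ _ _ → refl)
                                         (≈⇒sameCoset (imageE κ̂-aut ∅E) (φ α) (conjugate κ̂ (α · γ)) (φ-decomposed α)) ⟩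
    actG κ̂-aut (actS γ (atom α))    ∎
    where open ≤P-Reasoning

  on-edges : (e : Edge G) (α : Perm p) → f (edgeFace e α) ∼ actG κ̂-aut (actS γ (edgeFace e α))
  on-edges e α = begin-equality
    f (edgeFace e α)                      ≈⟨ labelled α e ⟩
    edgeFace (label e) (φ α)              ≈⟨ face-∼ (singleE (label e)) (imageE κ̂-aut (singleE e)) (φ α) (conjugate κ̂ (α · γ))
                                               (imageE-singleE κ̂-aut e (label e) (label-image e))
                                               (≈⇒sameCoset (imageE κ̂-aut (singleE e)) (φ α) (conjugate κ̂ (α · γ)) (φ-decomposed α)) ⟩
    actG κ̂-aut (actS γ (edgeFace e α))    ∎
    where open ≤P-Reasoning

  decomposition : (x : Elem G) → f x ∼ actG κ̂-aut (actS γ x)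
  decomposition = agreeing-on-atoms-and-edges A (∘-isPosetAut (actS-isPosetAut γ) (actG-isPosetAut κ̂-aut))
                    on-atoms on-edges

module _ {G : Graph p} {f : Elem G → Elem G} (A : IsPosetAut G f) where
  open Automorphism A

  GraphAut-id : GraphAut G
  GraphAut-id = record { perm = Permutation.id ; preserve = λ _ _ → refl }

  trivial-decomposition : Irrelevant (Fin p) → (x : Elem G) → f x ∼ actG GraphAut-id (actS Permutation.id x)
  trivial-decomposition all-equal =
    agreeing-on-atoms-and-edges A (∘-isPosetAut (actS-isPosetAut Permutation.id) (actG-isPosetAut GraphAut-id))
      (λ α → ∼-trans (φ-atom α) (face-∼ ∅E (imageE GraphAut-id ∅E) (φ α) (conjugate Permutation.id (α · Permutation.id))
                                   (λ _ _ → refl) (≈⇒sameCoset (imageE GraphAut-id ∅E) (φ α) (conjugate Permutation.id (α · Permutation.id))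
                                     (λ _ → all-equal _ _))))
      (λ e α → contradiction (all-equal (end₁ e) (end₂ e)) (end₁≢end₂ e))

first-edge : {G : Graph p} {a b : Fin p} → Reach G a b → a ≢ b → Edge G
first-edge here                   a≢a = contradiction refl a≢a
first-edge (step {i} {k} i~k _) _   = mkEdge i k i~k

third-point : (n : ℕ) → ThirdPoint (3 + n)
third-point n z w with avoids zero | avoids (suc zero) | avoids (suc (suc zero))
  where
  avoids : (c : Fin (3 + n)) → (c ≢ z × c ≢ w) ⊎ (c ≡ z ⊎ c ≡ w)
  avoids c with c ≟ z | c ≟ w
  ... | yes c≡z | _       = inj₂ (inj₁ c≡z)
  ... | no _    | yes c≡w = inj₂ (inj₂ c≡w)
  ... | no c≢z  | no c≢w  = inj₁ (c≢z , c≢w)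
... | inj₁ free | _ | _ = zero , free
... | inj₂ _ | inj₁ free | _ = suc zero , free
... | inj₂ _ | inj₂ _ | inj₁ free = suc (suc zero) , free
... | inj₂ (inj₁ refl) | inj₂ (inj₁ ()) | _
... | inj₂ (inj₁ refl) | inj₂ (inj₂ refl) | inj₂ (inj₁ ())
... | inj₂ (inj₁ refl) | inj₂ (inj₂ refl) | inj₂ (inj₂ ())
... | inj₂ (inj₂ refl) | inj₂ (inj₁ refl) | inj₂ (inj₁ ())
... | inj₂ (inj₂ refl) | inj₂ (inj₁ refl) | inj₂ (inj₂ ())
... | inj₂ (inj₂ refl) | inj₂ (inj₂ ()) | _

connected-two-vertices : (G : Graph 2) → Connected G → numEdges G ≡ 1
connected-two-vertices G connected =
  cong (λ es → length (filter (λ e → toℕ (proj₁ e) <? toℕ (proj₂ e)) es)) adjacent-pairs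
  where
  0~1 : adj G zero (suc zero) ≡ true
  0~1 with connected zero (suc zero)
  ... | step {k = zero} 0~0 _     = contradiction (trans (sym 0~0) (adj-irr G zero)) λ ()
  ... | step {k = suc zero} 0~1 _ = 0~1
  adjacent? = λ (e : Fin 2 × Fin 2) → adj G (proj₁ e) (proj₂ e) Bool.≟ true
  loop : (i : Fin 2) → adj G i i ≢ true
  loop i i~i = contradiction (trans (sym i~i) (adj-irr G i)) λ ()
  adjacent-pairs : filter adjacent? ((zero , zero) ∷ (zero , suc zero) ∷ (suc zero , zero) ∷ (suc zero , suc zero) ∷ [])
                   ≡ (zero , suc zero) ∷ (suc zero , zero) ∷ []
  adjacent-pairs = begin
    filter adjacent? ((zero , zero) ∷ (zero , suc zero) ∷ (suc zero , zero) ∷ (suc zero , suc zero) ∷ [])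
      ≡⟨ filter-reject adjacent? (loop zero) ⟩
    filter adjacent? ((zero , suc zero) ∷ (suc zero , zero) ∷ (suc zero , suc zero) ∷ [])
      ≡⟨ filter-accept adjacent? 0~1 ⟩
    (zero , suc zero) ∷ filter adjacent? ((suc zero , zero) ∷ (suc zero , suc zero) ∷ [])
      ≡⟨ cong ((zero , suc zero) ∷_) (filter-accept adjacent? (trans (adj-sym G _ _) 0~1)) ⟩
    (zero , suc zero) ∷ (suc zero , zero) ∷ filter adjacent? ((suc zero , suc zero) ∷ [])
      ≡⟨ cong (λ es → (zero , suc zero) ∷ (suc zero , zero) ∷ es) (filter-reject adjacent? (loop (suc zero))) ⟩
    (zero , suc zero) ∷ (suc zero , zero) ∷ [] ∎
    where open ≡-Reasoning

vertex-cases : (p : ℕ) (G : Graph p) → Connected G → numEdges G ≢ 1 → Irrelevant (Fin p) ⊎ (ThirdPoint p × Edge G)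
vertex-cases zero                G _         _   = inj₁ λ ()
vertex-cases (suc zero)          G _         _   = inj₁ λ { zero zero → refl }
vertex-cases (suc (suc zero))    G connected q≢1 = contradiction (connected-two-vertices G connected) q≢1
vertex-cases (suc (suc (suc n))) G connected _   =
  inj₂ (third-point n , first-edge (connected zero (suc zero)) λ ())

theorem3 : ∀ (p : ℕ) (G : Graph p) → Connected G → numEdges G ≢ 1 →
    ((γ : Perm p) → IsPosetAut G (actS γ)) ×
    ((κ : GraphAut G) → IsPosetAut G (actG κ)) ×
    ((γ : Perm p) (κ : GraphAut G) (x : Elem G) →
      actG κ (actS γ x) ∼ actS (perm κ · γ · (perm κ ⁻¹)) (actG κ x)) ×
    ((f : Elem G → Elem G) → IsPosetAut G f →
      Σ (Perm p) λ γ → Σ (GraphAut G) λ κ → (x : Elem G) → f x ∼ actG κ (actS γ x)) ×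
    ((γ γ′ : Perm p) (κ κ′ : GraphAut G) →
      ((x : Elem G) → actG κ (actS γ x) ∼ actG κ′ (actS γ′ x)) →
      (γ ≈ₚ γ′) × (perm κ ≈ₚ perm κ′))
theorem3 p G connected q≢1 = actS-isPosetAut , actG-isPosetAut , actG-actS , decompose , unique
  where
  decompose : (f : Elem G → Elem G) → IsPosetAut G f →
    Σ (Perm p) λ γ → Σ (GraphAut G) λ κ → (x : Elem G) → f x ∼ actG κ (actS γ x)
  decompose f A with vertex-cases p G connected q≢1
  ... | inj₁ all-equal    = Permutation.id , GraphAut-id A , trivial-decomposition A all-equal
  ... | inj₂ (third , e₀) = γ , κ̂-aut , decomposition
    where open Decomposition connected third e₀ A
  unique : (γ γ′ : Perm p) (κ κ′ : GraphAut G) → ((x : Elem G) → actG κ (actS γ x) ∼ actG κ′ (actS γ′ x)) →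
    (γ ≈ₚ γ′) × (perm κ ≈ₚ perm κ′)
  unique γ γ′ κ κ′ with vertex-cases p G connected q≢1
  ... | inj₁ all-equal = λ _ → (λ _ → all-equal _ _) , (λ _ → all-equal _ _)
  ... | inj₂ (third , _) = decomposition-unique third γ γ′ κ κ′
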